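{- In the setting described in the context, with probability at least $1/2$ with respect to the choice of the random values $\rho$, the average hub set size satisfies $$\frac{1}{n}\sum_{u \in V}|S(u)| = O\Big(\frac{1}{n}\sum_{u \in V} \mathrm{isk}(u)\Big) \leq O(k \log D),$$ where the constants hidden in the $O$-notation are absolute.
   Context: Let $G=(V\cup V^+,E)$ be a finite unweighted graph with a distinguished set $V$ of terminal nodes, $n:=|V|$, in which every node of $V^+$ has degree $2$. Each $u\in V$ is associated with a fixed tree $T_u\subseteq G$, rooted at $u$ and containing all nodes of $V$. For nodes $v,w$ of $T_u$, $P_u(v,w)$ is the unique path between $v$ and $w$ in $T_u$, $P_u(v):=P_u(u,v)$, $|P|$ denotes the number of edges of a path $P$, and $d_u(v):=|P_u(v)|$. It is assumed that $P_u(v)=P_v(u)$ for all $u,v\in V$, and that $|P_u(v,w)|$ is an integer multiple of $12$ for all $u,v,w\in V$. Orient $T_u$ from the root to the leaves; for a node $v$ of $T_u$, $\mathrm{reach}_{T_u}(v)$ is the maximum of $d_u(x)-d_u(v)$ over descendants $x$ of $v$ in $T_u$ (including $v$). The skeleton of $T_u$ is $T_u^*:=T_u[V_u^*]$ with $V_u^*:=\{v\in V(T_u): \mathrm{reach}_{T_u}(v)\ge \tfrac12 d_u(v)\}$. For integers $r\ge 0$, $\mathrm{cut}_u^{*(r)}:=\{v\in V_u^*: d_u(v)=r\}$. The skeleton dimension is $k:=\max_{u\in V}\max_{r}|\mathrm{cut}_u^{*(r)}|$, and $D:=\max_{u\in V}\mathrm{diam}(T_u)$. The integrated skeleton dimension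 of $u$ is $\mathrm{isk}(u):=\sum_{v\in V_u^*, v\neq u} \frac{1}{d_u(v)}=\sum_{r\ge 1}\frac{|\mathrm{cut}_u^{*(r)}|}{r}$. Random hub construction: each edge $e\in E$ receives a value $\rho(e)\in[0,1]$ uniformly and independently at random (all values are distinct with probability 1). For $u,v\in V$, $v\ne u$, the central subpath is $P_u'(v):=P_u(u',v')$, where $u',v'\in P_u(v)$ satisfy $d_u(u')=\tfrac{5}{12}d_u(v)$ and $d_u(v')=\tfrac{7}{12}d_u(v)$; the hub edge is $\eta_u(v):=\arg\min_{e\in P_u'(v)}\rho(e)$; and the (edge) hub set of $u$ is $S(u):=\{\eta_u(v): v\in V, v\ne u\}$. -}

module Defs where

open import Data.Nat as ℕ using (ℕ; zero; suc; _+_; _*_; _∸_; _≤_; _<_; _<ᵇ_; _≤ᵇ_; _⊔_)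
open import Data.Nat.Divisibility using (_∣_)
open import Data.Nat.Logarithm using (⌊log₂_⌋)
open import Data.Integer using (+_)
open import Data.Rational as ℚ using (ℚ; 0ℚ)
open import Data.Fin as Fin using (Fin)
open import Data.Fin.Properties using () renaming (_≟_ to _≟F_)
open import Data.Sum using (_⊎_; inj₁; inj₂)
open import Data.Sum.Properties using (≡-dec)
open import Data.Product using (_×_; _,_)
open import Data.Bool using (Bool; true; false; _∧_; _∨_; not; if_then_else_)
open import Data.List using (List; []; _∷_; map; concatMap; foldr; length; filterᵇ; allFin; reverse)
open import Data.Bool.ListAction using (any; all)
open import Data.Nat.ListAction using (sum)
open import Data.Vec using (Vec; lookup) renaming ([] to []ᵥ; _∷_ to _∷ᵥ_)
open import Data.Maybe using (Maybe; just; nothing)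
open import Relation.Binary.PropositionalEquality using (_≡_; _≢_)
open import Relation.Nullary.Decidable using (⌊_⌋)

maxℕ : List ℕ → ℕ
maxℕ = foldr _⊔_ 0

countᵇ : {A : Set} → (A → Bool) → List A → ℕ
countᵇ p xs = length (filterᵇ p xs)

allVecs : (b a : ℕ) → List (Vec (Fin b) a)
allVecs b zero    = []ᵥ ∷ []
allVecs b (suc a) = concatMap (λ v → map (λ i → i ∷ᵥ v) (allFin b)) (allVecs b a)

ℕ→ℚ : ℕ → ℚ
ℕ→ℚ k = (+ k) ℚ./ 1

sumℚ : List ℚ → ℚ
sumℚ = foldr ℚ._+_ 0ℚ

-- 1/d as a rational (only used for d ≥ 1; value 0 at d = 0 is irrelevant)
inv : ℕ → ℚ
inv zero    = 0ℚ
inv (suc d) = (+ 1) ℚ./ (suc d)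

-- Nodes: V = Fin n (terminals) and V⁺ = Fin m.  Edges: Fin M, edge e joins
-- end₁ e and end₂ e; the graph is simple (no loops, no parallel edges).
-- For every terminal u, the rooted tree T_u ⊆ G is given by its node set
-- (inT u), its depth function (dep u = d_u), the parent map (par u) and,
-- for each non-root node x, the index (pe u x) of the edge of G joining x to
-- its parent.  The depth of a parent is one less, so following parents
-- reaches the root u; the tree edges are the edges pe u x.

Node : ℕ → ℕ → Set
Node n m = Fin n ⊎ Fin m

_≟N_ : ∀ {n m} → (x y : Node n m) → _
_≟N_ = ≡-dec _≟F_ _≟F_

_==_ : ∀ {n m} → Node n m → Node n m → Bool
x == y = ⌊ x ≟N y ⌋

allNodes : (n m : ℕ) → List (Node n m)
allNodes n m = map inj₁ (allFin n) Data.List.++ map inj₂ (allFin m)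

record Raw : Set where
  field
    n m M : ℕ
    end₁ end₂ : Fin M → Node n m
    inT : Fin n → Node n m → Bool
    dep : Fin n → Node n m → ℕ
    par : Fin n → Node n m → Node n m
    pe  : Fin n → Node n m → Fin M

module RawOps (R : Raw) where
  open Raw R public

  joins : Fin M → Node n m → Node n m → Set
  joins e x y = (end₁ e ≡ x × end₂ e ≡ y) ⊎ (end₁ e ≡ y × end₂ e ≡ x)

  incident : Node n m → Fin M → Bool
  incident x e = (end₁ e == x) ∨ (end₂ e == x)

  chain : Fin n → ℕ → Node n m → List (Node n m)
  chain u zero    x = x ∷ []
  chain u (suc j) x = x ∷ chain u j (par u x)

  pathNodes : Fin n → Node n m → List (Node n m)
  pathNodes u x = chain u (dep u x) x

  isAnc : Fin n → Node n m → Node n m → Bool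
  isAnc u y x = any (_== y) (pathNodes u x)

  lcaDepth : Fin n → Node n m → Node n m → ℕ
  lcaDepth u x y = maxℕ (map (dep u) (filterᵇ (λ z → isAnc u z y) (pathNodes u x)))

  treeDist : Fin n → Node n m → Node n m → ℕ
  treeDist u x y = (dep u x + dep u y) ∸ (2 * lcaDepth u x y)

  Nodes : List (Node n m)
  Nodes = allNodes n m

  reach : Fin n → Node n m → ℕ
  reach u v = maxℕ (map (λ x → dep u x ∸ dep u v)
                        (filterᵇ (λ x → inT u x ∧ isAnc u v x) Nodes))

  inSkel : Fin n → Node n m → Bool
  inSkel u v = inT u v ∧ (dep u v ≤ᵇ 2 * reach u v)

  cutSize : Fin n → ℕ → ℕ
  cutSize u r = countᵇ (λ v → inSkel u v ∧ ⌊ dep u v ℕ.≟ r ⌋) Nodes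

  -- skeleton dimension k (depths in T_u are < n + m, so r ranges over 0 .. n+m)
  skelDim : ℕ
  skelDim = maxℕ (concatMap (λ u → map (cutSize u) (Data.List.upTo (suc (n + m)))) (allFin n))

  diamMax : ℕ
  diamMax = maxℕ (concatMap (λ u →
              concatMap (λ x → map (treeDist u x)
                                   (filterᵇ (inT u) Nodes))
                        (filterᵇ (inT u) Nodes)) (allFin n))

  isk : Fin n → ℚ
  isk u = sumℚ (map (λ v → inv (dep u v))
                    (filterᵇ (λ v → inSkel u v ∧ not (v == inj₁ u)) Nodes))

  -- Hub sets.  The values ρ(e) matter only through their relative order,
  -- so ρ is represented by the (a.s. well defined) ranking Fin M → Fin M.

  central : Fin n → Fin n → List (Fin M)
  central u v = map (pe u)
    (filterᵇ (λ x → (5 * d <ᵇ 12 * dep u x) ∧ (12 * dep u x ≤ᵇ 7 * d))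
             (pathNodes u (inj₁ v)))
    where d = dep u (inj₁ v)

  argminBy : (Fin M → Fin M) → List (Fin M) → Maybe (Fin M)
  argminBy ρ []       = nothing
  argminBy ρ (e ∷ es) with argminBy ρ es
  ... | nothing = just e
  ... | just f  = if Fin.toℕ (ρ e) <ᵇ Fin.toℕ (ρ f) then just e else just f

  hub : (Fin M → Fin M) → Fin n → Fin n → Maybe (Fin M)
  hub ρ u v = argminBy ρ (central u v)

  hubSetSize : (Fin M → Fin M) → Fin n → ℕ
  hubSetSize ρ u = countᵇ (λ e → any (λ v → not ⌊ v ≟F u ⌋ ∧ isJust e (hub ρ u v)) (allFin n))
                          (allFin M)
    where
    isJust : Fin M → Maybe (Fin M) → Bool
    isJust e nothing  = false
    isJust e (just f) = ⌊ e ≟F f ⌋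

  -- Random orderings: all injective rankings of the edges (uniform
  -- distribution of the order of i.i.d. uniform values ρ(e))

  injᵇ : Vec (Fin M) M → Bool
  injᵇ v = all (λ i → all (λ j → ⌊ i ≟F j ⌋ ∨ not ⌊ lookup v i ≟F lookup v j ⌋) (allFin M)) (allFin M)

  rankings : List (Vec (Fin M) M)
  rankings = filterᵇ injᵇ (allVecs M M)

  sumS : (Fin M → Fin M) → ℕ
  sumS ρ = sum (map (hubSetSize ρ) (allFin n))

  sumIsk : ℚ
  sumIsk = sumℚ (map isk (allFin n))

record Valid (R : Raw) : Set where
  open RawOps R
  field
      noLoop   : ∀ e → end₁ e ≢ end₂ e
      noMulti  : ∀ e f x y → joins e x y → joins f x y → e ≡ f
      degTwo   : ∀ (x : Fin m) → countᵇ (incident (inj₂ x)) (allFin M) ≡ 2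
      rootIn   : ∀ u → inT u (inj₁ u) ≡ true
      rootDep  : ∀ u → dep u (inj₁ u) ≡ 0
      termIn   : ∀ u v → inT u (inj₁ v) ≡ true
      parIn    : ∀ u x → inT u x ≡ true → x ≢ inj₁ u → inT u (par u x) ≡ true
      parDep   : ∀ u x → inT u x ≡ true → x ≢ inj₁ u → dep u x ≡ suc (dep u (par u x))
      parEdge  : ∀ u x → inT u x ≡ true → x ≢ inj₁ u → joins (pe u x) x (par u x)
      symPath  : ∀ u v → pathNodes u (inj₁ v) ≡ reverse (pathNodes v (inj₁ u))
      mult12   : ∀ u v w → 12 ∣ treeDist u (inj₁ v) (inj₁ w)

{-# OPTIONS --safe #-}
module Submission where

-- Fix u and a ranking ρ of the edges. The hub η_u(v) is the ρ-least edge of the central part of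
-- P_u(v); let r be the depth of its lower endpoint x and d = d_u(v). If d < 2r, then x is in the
-- skeleton and the segment of the ⌊r/8⌋ + 1 tree edges above x lies in the central part, so η_u(v)
-- is the ρ-least edge of that segment and its bottom edge. Otherwise the node w of P_u(v) at depth
-- r + ⌊(r-1)/7⌋ is in the skeleton and η_u(v) is the ρ-least edge and the top edge of the segment
-- above w. So |S(u)| is at most the number of skeleton nodes y for which an end edge of the segment
-- above y is ρ-least on it. By exchangeability of the ranking, this happens with probability at
-- most 2/(⌊d_u(y)/8⌋ + 1) ≤ 16/d_u(y); summing, E ∑_u |S(u)| ≤ 16 ∑_u isk(u), and Markov's
-- inequality gives the bound 32 ∑_u isk(u) with probability at least 1/2. Finally, grouping the
-- skeleton nodes by depth, isk(u) ≤ k H_{D-1} ≤ 2k log₂ D.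

open import Defs
open import Data.Nat.DivMod using (m≡m%n+[m/n]*n; m%n<n; m/n*n≤m; m/n<m; m/n≤m; m<n⇒m/n≡0; m*n/n≡m; +-distrib-/-∣ʳ)
open import Data.Nat.Divisibility using (n∣m*n)
open import Data.Nat.Induction using (<-wellFounded)
open import Data.Nat.ListAction using (sum)
open import Data.Nat.Logarithm using (⌊log₂_⌋; ⌊log₂⌋-mono-≤; ⌊log₂⌊n/2⌋⌋≡⌊log₂n⌋∸1)
open import Data.Nat.Tactic.RingSolver using (solve-∀)
open import Data.Integer as ℤ using (ℤ; +≤+)
import Data.Integer.Properties as ℤP
import Data.Integer.Tactic.RingSolver as ℤSolver
open import Data.Rational as ℚ using (ℚ; 0ℚ; 1ℚ; toℚᵘ; _≤ᵇ_) renaming (_+_ to _+ℚ_; _*_ to _*ℚ_; _≤_ to _≤ℚ_)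
import Data.Rational.Properties as ℚP
open import Data.Rational.Solver using (module +-*-Solver)
open import Data.Rational.Unnormalised as ℚᵘ using (ℚᵘ; mkℚᵘ; *≡*; *≤*)
import Data.Rational.Unnormalised.Properties as ℚᵘP
open import Data.Bool using (Bool; true; false; T; _∧_; _∨_; not; if_then_else_)
open import Data.Bool.ListAction using (all; any)
open import Data.Bool.Properties using (T-∧; T-≡)
open import Data.Fin using (Fin; toℕ)
open import Data.Fin.Properties using (toℕ-injective) renaming (_≟_ to _≟ᶠ_)
import Data.Fin.Permutation.Components as PC
open import Data.Vec as Vec using (Vec; lookup) renaming ([] to []ᵥ; _∷_ to _∷ᵥ_)
open import Data.Vec.Properties using (lookup∘tabulate; tabulate∘lookup; tabulate-cong) renaming (≡-dec to ≡-decᵥ)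
open import Data.List using (List; []; _∷_; foldr; map; length; filterᵇ; concatMap; _++_; allFin; downFrom)
open import Data.List.Properties using (length-map; length-++; length-tabulate; filter-all)
open import Data.List.Membership.Propositional using (_∈_)
open import Data.List.Membership.Propositional.Properties
  using (∈-allFin; ∈-map⁺; ∈-map⁻; ∈-++⁺ˡ; ∈-++⁺ʳ; ∈-filter⁺; ∈-filter⁻; ∈-concat⁺′; ∈-upTo⁺; ∈-downFrom⁺)
open import Data.List.Relation.Unary.Any as Any using (here; there)
open import Data.List.Relation.Unary.Any.Properties using (any⁺; any⁻)
open import Data.List.Relation.Unary.All as All using (All; []; _∷_)
open import Data.List.Relation.Unary.All.Properties using (all⁺; all⁻) renaming (map⁺ to All-map⁺)
open import Data.List.Relation.Unary.AllPairs using ([]; _∷_)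
open import Data.List.Relation.Unary.Unique.Propositional using (Unique)
open import Data.List.Relation.Unary.Unique.Propositional.Properties using (allFin⁺; downFrom⁺)
open import Data.Product using (Σ-syntax; ∃-syntax; _×_; _,_; proj₁; proj₂)
open import Data.Maybe using (just; nothing)
open import Data.Sum using (_⊎_; inj₁; inj₂; reduce)
open import Data.Empty using (⊥; ⊥-elim)
open import Data.Unit using (tt)
open import Function using (_∘_; const)
open import Function.Bundles using (Equivalence)
open import Function.Definitions using (Injective)
open import Induction.WellFounded using (Acc; acc)
open import Level using (0ℓ)
open import Algebra.Bundles using (CommutativeSemiring; CommutativeRing)
import Algebra.Properties.CommutativeSemigroup
open import Relation.Binary.Definitions using (DecidableEquality; tri<; tri≈; tri>)
open import Relation.Binary.PropositionalEquality as ≡ using (_≡_)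
import Relation.Binary.Reasoning.Setoid as ≈-Reasoning
open import Relation.Nullary using (Dec; yes; no)
open import Relation.Nullary.Decidable using (⌊_⌋; T?; dec-true; does; fromWitness; fromWitnessFalse; toWitnessFalse)

module ListSum (R : CommutativeSemiring 0ℓ 0ℓ) where
  open CommutativeSemiring R
  open ≈-Reasoning setoid

  ∑ : {A : Set} → List A → (A → Carrier) → Carrier
  ∑ xs f = foldr _+_ 0# (map f xs)

  module _ {A : Set} where

    ∑-cong : ∀ xs {f g : A → Carrier} → (∀ {x} → x ∈ xs → f x ≈ g x) → ∑ xs f ≈ ∑ xs g
    ∑-cong []       eq = refl
    ∑-cong (x ∷ xs) eq = +-cong (eq (here ≡.refl)) (∑-cong xs (eq ∘ there))

    ∑-≗ : ∀ xs {f g : A → Carrier} → (∀ x → f x ≈ g x) → ∑ xs f ≈ ∑ xs g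
    ∑-≗ xs eq = ∑-cong xs (λ {x} _ → eq x)

    ∑-zero : ∀ (xs : List A) → ∑ xs (const 0#) ≈ 0#
    ∑-zero []       = refl
    ∑-zero (x ∷ xs) = trans (+-identityˡ _) (∑-zero xs)

    ∑-distrib-+ : ∀ xs (f g : A → Carrier) → ∑ xs (λ x → f x + g x) ≈ ∑ xs f + ∑ xs g
    ∑-distrib-+ []       f g = sym (+-identityˡ 0#)
    ∑-distrib-+ (x ∷ xs) f g = begin
      (f x + g x) + ∑ xs (λ x → f x + g x) ≈⟨ +-congˡ (∑-distrib-+ xs f g) ⟩
      (f x + g x) + (∑ xs f + ∑ xs g)       ≈⟨ CSP.interchange (f x) (g x) (∑ xs f) (∑ xs g) ⟩
      (f x + ∑ xs f) + (g x + ∑ xs g)       ∎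
      where module CSP = Algebra.Properties.CommutativeSemigroup +-commutativeSemigroup

    ∑-*ˡ : ∀ xs c (f : A → Carrier) → ∑ xs (λ x → c * f x) ≈ c * ∑ xs f
    ∑-*ˡ []       c f = sym (zeroʳ c)
    ∑-*ˡ (x ∷ xs) c f = trans (+-congˡ (∑-*ˡ xs c f)) (sym (distribˡ c (f x) _))

    ∑-*ʳ : ∀ xs c (f : A → Carrier) → ∑ xs (λ x → f x * c) ≈ ∑ xs f * c
    ∑-*ʳ xs c f = trans (∑-≗ xs (λ x → *-comm (f x) c)) (trans (∑-*ˡ xs c f) (*-comm c _))

    ∑-++ : ∀ xs ys (f : A → Carrier) → ∑ (xs ++ ys) f ≈ ∑ xs f + ∑ ys f
    ∑-++ []       ys f = sym (+-identityˡ _)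
    ∑-++ (x ∷ xs) ys f = trans (+-congˡ (∑-++ xs ys f)) (sym (+-assoc (f x) _ _))

    ∑-filterᵇ : ∀ (p : A → Bool) xs (f : A → Carrier) →
                ∑ (filterᵇ p xs) f ≈ ∑ xs (λ x → if p x then f x else 0#)
    ∑-filterᵇ p []       f = refl
    ∑-filterᵇ p (x ∷ xs) f with p x
    ... | true  = +-congˡ (∑-filterᵇ p xs f)
    ... | false = trans (∑-filterᵇ p xs f) (sym (+-identityˡ _))

  module _ {A B : Set} where

    ∑-map : ∀ xs (g : A → B) (f : B → Carrier) → ∑ (map g xs) f ≡ ∑ xs (f ∘ g)
    ∑-map []       g f = ≡.refl
    ∑-map (x ∷ xs) g f = ≡.cong (f (g x) +_) (∑-map xs g f)

    ∑-concatMap : ∀ xs (g : A → List B) (f : B → Carrier) → ∑ (concatMap g xs) f ≈ ∑ xs (λ x → ∑ (g x) f)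
    ∑-concatMap []       g f = refl
    ∑-concatMap (x ∷ xs) g f = trans (∑-++ (g x) (concatMap g xs) f) (+-congˡ (∑-concatMap xs g f))

    ∑-comm : ∀ xs ys (f : A → B → Carrier) → ∑ xs (λ x → ∑ ys (f x)) ≈ ∑ ys (λ y → ∑ xs (λ x → f x y))
    ∑-comm []       ys f = sym (∑-zero ys)
    ∑-comm (x ∷ xs) ys f = trans (+-congˡ (∑-comm xs ys f)) (sym (∑-distrib-+ ys (f x) (λ y → ∑ xs (λ x → f x y))))

-- Opened only here, since the semiring operations of ListSum reuse these names.
open import Data.Nat as ℕ using (ℕ; zero; suc; _+_; _*_; _∸_; _≤_; _<_; z≤n; s≤s; _/_; _%_; _<ᵇ_; _<?_; ⌊_/2⌋; ⌈_/2⌉)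
open import Data.Nat.Properties
open import Relation.Binary.PropositionalEquality

open ListSum +-*-commutativeSemiring

𝟙 : Bool → ℕ
𝟙 true  = 1
𝟙 false = 0

𝟙-T : ∀ {b} → T b → 𝟙 b ≡ 1
𝟙-T {true} _ = refl

module _ {A : Set} where

  ∑-mono-≤ : ∀ xs {f g : A → ℕ} → (∀ {x} → x ∈ xs → f x ≤ g x) → ∑ xs f ≤ ∑ xs g
  ∑-mono-≤ []       le = z≤n
  ∑-mono-≤ (x ∷ xs) le = +-mono-≤ (le (here refl)) (∑-mono-≤ xs (le ∘ there))

  ∑-const : ∀ (xs : List A) c → ∑ xs (const c) ≡ length xs * c
  ∑-const []       c = refl
  ∑-const (x ∷ xs) c = cong (c +_) (∑-const xs c)

  ∑-1 : ∀ (xs : List A) → ∑ xs (const 1) ≡ length xs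
  ∑-1 xs = trans (∑-const xs 1) (*-identityʳ (length xs))

  length-filterᵇ : ∀ (p : A → Bool) xs → length (filterᵇ p xs) ≡ ∑ xs (𝟙 ∘ p)
  length-filterᵇ p []       = refl
  length-filterᵇ p (x ∷ xs) with p x
  ... | true  = cong suc (length-filterᵇ p xs)
  ... | false = length-filterᵇ p xs

  ≤-∑ : ∀ {xs} (f : A → ℕ) {x} → x ∈ xs → f x ≤ ∑ xs f
  ≤-∑ {y ∷ xs} f (here refl) = m≤m+n (f y) _
  ≤-∑ {y ∷ xs} f (there x∈) = ≤-trans (≤-∑ f x∈) (m≤n+m _ (f y))

module Multiplicity {A : Set} (_≟_ : DecidableEquality A) where

  δ : A → A → ℕ
  δ x y with x ≟ y
  ... | yes _ = 1
  ... | no  _ = 0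

  δ-cases : ∀ x y → (x ≡ y × δ x y ≡ 1) ⊎ (x ≢ y × δ x y ≡ 0)
  δ-cases x y with x ≟ y
  ... | yes x≡y = inj₁ (x≡y , refl)
  ... | no  x≢y = inj₂ (x≢y , refl)

  δ-refl : ∀ x → δ x x ≡ 1
  δ-refl x with δ-cases x x
  ... | inj₁ (_ , eq)  = eq
  ... | inj₂ (x≢x , _) = ⊥-elim (x≢x refl)

  δ-≢ : ∀ {x y} → x ≢ y → δ x y ≡ 0
  δ-≢ {x} {y} x≢y with δ-cases x y
  ... | inj₁ (x≡y , _) = ⊥-elim (x≢y x≡y)
  ... | inj₂ (_ , eq)  = eq

  δ-sym : ∀ x y → δ x y ≡ δ y x
  δ-sym x y with δ-cases x y
  ... | inj₁ (refl , eq) = refl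
  ... | inj₂ (x≢y , eq)  = trans eq (sym (δ-≢ (x≢y ∘ sym)))

  δ-*-subst : ∀ x y (h : A → ℕ) → δ x y * h x ≡ δ x y * h y
  δ-*-subst x y h with δ-cases x y
  ... | inj₁ (refl , _) = refl
  ... | inj₂ (_ , eq) rewrite eq = refl

  mult : A → List A → ℕ
  mult z xs = ∑ xs (λ x → δ x z)

  ∑-δ-* : ∀ xs z (h : A → ℕ) → ∑ xs (λ x → δ x z * h x) ≡ mult z xs * h z
  ∑-δ-* xs z h = trans (∑-≗ xs (λ x → δ-*-subst x z h)) (∑-*ʳ xs (h z) (λ x → δ x z))

  mult-∈ : ∀ {z} xs → z ∈ xs → 1 ≤ mult z xs
  mult-∈ {z} xs z∈ = subst (_≤ mult z xs) (δ-refl z) (≤-∑ (λ x → δ x z) z∈)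

  mult-absent : ∀ {z} ys → All (z ≢_) ys → mult z ys ≡ 0
  mult-absent []       []           = refl
  mult-absent (y ∷ ys) (z≢y ∷ z∉ys) rewrite δ-≢ (z≢y ∘ sym) = mult-absent ys z∉ys

  mult-unique : ∀ z {xs} → Unique xs → mult z xs ≤ 1
  mult-unique z {[]}     _            = z≤n
  mult-unique z {x ∷ xs} (x∉ ∷ uniq) with δ-cases x z
  ... | inj₁ (refl , eq) rewrite eq | mult-absent xs x∉ = ≤-refl
  ... | inj₂ (_ , eq) rewrite eq = mult-unique z uniq

  mult-unique-∈ : ∀ {z xs} → Unique xs → z ∈ xs → mult z xs ≡ 1
  mult-unique-∈ {z} {xs} uniq z∈ = ≤-antisym (mult-unique z uniq) (mult-∈ xs z∈)

  -- Both sides equal ∑_{x,y ∈ W} [y = σ x] h y, read once along x and once along y.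
  ∑-reindex : ∀ W → (∀ z → mult z W ≡ 1) → (σ σ⁻¹ : A → A) →
              (∀ x → σ (σ⁻¹ x) ≡ x) → (∀ x → σ⁻¹ (σ x) ≡ x) →
              (h : A → ℕ) → ∑ W (h ∘ σ) ≡ ∑ W h
  ∑-reindex W once σ σ⁻¹ σσ⁻¹ σ⁻¹σ h =
    begin
      ∑ W (h ∘ σ)
    ≡⟨ ∑-≗ W (λ x → sym (pick (σ x))) ⟩
      ∑ W (λ x → ∑ W (λ y → δ y (σ x) * h y))
    ≡⟨ ∑-comm W W (λ x y → δ y (σ x) * h y) ⟩
      ∑ W (λ y → ∑ W (λ x → δ y (σ x) * h y))
    ≡⟨ ∑-≗ W (λ y → ∑-≗ W (λ x → cong (_* h y) (δ-transpose x y))) ⟩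
      ∑ W (λ y → ∑ W (λ x → δ x (σ⁻¹ y) * h y))
    ≡⟨ ∑-≗ W (λ y → trans (∑-*ʳ W (h y) (λ x → δ x (σ⁻¹ y))) (cong (_* h y) (once (σ⁻¹ y)))) ⟩
      ∑ W (λ y → 1 * h y)
    ≡⟨ ∑-≗ W (λ y → *-identityˡ (h y)) ⟩
      ∑ W h
    ∎
    where
    open ≡-Reasoning
    pick : ∀ z → ∑ W (λ y → δ y z * h y) ≡ h z
    pick z = trans (∑-δ-* W z h) (trans (cong (_* h z) (once z)) (*-identityˡ (h z)))
    δ-transpose : ∀ x y → δ y (σ x) ≡ δ x (σ⁻¹ y)
    δ-transpose x y with δ-cases y (σ x)
    ... | inj₁ (refl , eq) = trans eq (sym (trans (cong (δ x) (σ⁻¹σ x)) (δ-refl x)))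
    ... | inj₂ (y≢σx , eq) = trans eq (sym (δ-≢ (λ x≡σ⁻¹y → y≢σx (trans (sym (σσ⁻¹ y)) (cong σ (sym x≡σ⁻¹y))))))

  count-subsingleton : ∀ xs (p : A → Bool) → Unique xs →
                       (∀ {a b} → a ∈ xs → b ∈ xs → T (p a) → T (p b) → a ≡ b) → ∑ xs (𝟙 ∘ p) ≤ 1
  count-subsingleton []       p _            _   = z≤n
  count-subsingleton (x ∷ xs) p (x∉ ∷ uniq) one with p x in px
  ... | true  = ≤-reflexive (cong suc (none xs x∉ (λ b∈ pb → one (here refl) (there b∈) (Equivalence.from T-≡ px) pb)))
    where
    none : ∀ ys → All (x ≢_) ys → (∀ {b} → b ∈ ys → T (p b) → x ≡ b) → ∑ ys (𝟙 ∘ p) ≡ 0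
    none []       []           _    = refl
    none (y ∷ ys) (x≢y ∷ x∉ys) is-x with p y in py
    ... | true  = ⊥-elim (x≢y (is-x (here refl) (Equivalence.from T-≡ py)))
    ... | false = none ys x∉ys (is-x ∘ there)
  ... | false = count-subsingleton xs p uniq (λ a∈ b∈ → one (there a∈) (there b∈))

  -- Each y ∈ ys contributes at most one x = g y, as the elements of xs are distinct.
  count-≤-cover : ∀ {B : Set} xs (ys : List B) (p : A → Bool) (q : B → Bool) (g : B → A) → Unique xs →
                  (∀ {x} → x ∈ xs → T (p x) → ∃[ y ] (y ∈ ys × T (q y) × g y ≡ x)) →
                  ∑ xs (𝟙 ∘ p) ≤ ∑ ys (𝟙 ∘ q)
  count-≤-cover xs ys p q g uniq cover =
    begin
      ∑ xs (𝟙 ∘ p)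
    ≤⟨ ∑-mono-≤ xs covered ⟩
      ∑ xs (λ x → ∑ ys (λ y → δ (g y) x * 𝟙 (q y)))
    ≡⟨ ∑-comm xs ys _ ⟩
      ∑ ys (λ y → ∑ xs (λ x → δ (g y) x * 𝟙 (q y)))
    ≤⟨ ∑-mono-≤ ys (λ {y} _ → at-most-once (g y) (𝟙 (q y))) ⟩
      ∑ ys (𝟙 ∘ q)
    ∎
    where
    open ≤-Reasoning
    at-most-once : ∀ a c → ∑ xs (λ x → δ a x * c) ≤ c
    at-most-once a c = begin
      ∑ xs (λ x → δ a x * c)   ≡⟨ ∑-≗ xs (λ x → cong (_* c) (δ-sym a x)) ⟩
      ∑ xs (λ x → δ x a * c)   ≡⟨ ∑-*ʳ xs c (λ x → δ x a) ⟩
      mult a xs * c            ≤⟨ *-monoˡ-≤ c (mult-unique a uniq) ⟩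
      1 * c                    ≡⟨ *-identityˡ c ⟩
      c                        ∎
    covered : ∀ {x} → x ∈ xs → 𝟙 (p x) ≤ ∑ ys (λ y → δ (g y) x * 𝟙 (q y))
    covered {x} x∈ with p x in px
    ... | false = z≤n
    ... | true with cover x∈ (Equivalence.from T-≡ px)
    ...   | y , y∈ , qy , refl = begin
      1                          ≡⟨ sym (cong₂ _*_ (δ-refl (g y)) (𝟙-T qy)) ⟩
      δ (g y) (g y) * 𝟙 (q y)    ≤⟨ ≤-∑ (λ y′ → δ (g y′) (g y) * 𝟙 (q y′)) y∈ ⟩
      ∑ ys (λ y′ → δ (g y′) (g y) * 𝟙 (q y′)) ∎

  length-≤-unique-⊆ : ∀ xs ys → Unique xs → (∀ {x} → x ∈ xs → x ∈ ys) → length xs ≤ length ys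
  length-≤-unique-⊆ xs ys uniq xs⊆ys = begin
    length xs                             ≡⟨ sym (∑-1 xs) ⟩
    ∑ xs (const 1)                        ≤⟨ ∑-mono-≤ xs (λ x∈ → mult-∈ ys (xs⊆ys x∈)) ⟩
    ∑ xs (λ x → ∑ ys (λ y → δ y x))       ≡⟨ ∑-comm xs ys _ ⟩
    ∑ ys (λ y → ∑ xs (λ x → δ y x))       ≡⟨ ∑-≗ ys (λ y → ∑-≗ xs (δ-sym y)) ⟩
    ∑ ys (λ y → mult y xs)                ≤⟨ ∑-mono-≤ ys (λ {y} _ → mult-unique y uniq) ⟩
    ∑ ys (const 1)                        ≡⟨ ∑-1 ys ⟩
    length ys                             ∎
    where open ≤-Reasoning

module ℚ∑ = ListSum (CommutativeRing.commutativeSemiring ℚP.+-*-commutativeRing)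
open ℚ∑ using () renaming (∑ to ∑ℚ)

-- ℕ→ℚ and inv build normalised fractions; identities between them are proved on the unnormalised
-- representatives, where they become identities of integers.
private
  ℕ→ℚᵘ : ℕ → ℚᵘ
  ℕ→ℚᵘ k = mkℚᵘ (ℤ.+ k) 0

  toℚᵘ-ℕ→ℚ : ∀ k → toℚᵘ (ℕ→ℚ k) ℚᵘ.≃ ℕ→ℚᵘ k
  toℚᵘ-ℕ→ℚ k = ℚP.toℚᵘ-fromℚᵘ (ℕ→ℚᵘ k)

  toℚᵘ-inv : ∀ d → toℚᵘ (inv (suc d)) ℚᵘ.≃ mkℚᵘ (ℤ.+ 1) d
  toℚᵘ-inv d = ℚP.toℚᵘ-fromℚᵘ (mkℚᵘ (ℤ.+ 1) d)

  infixr 5 _⟨≃⟩_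
  _⟨≃⟩_ : ∀ {x y z} → x ℚᵘ.≃ y → y ℚᵘ.≃ z → x ℚᵘ.≃ z
  _⟨≃⟩_ = ℚᵘP.≃-trans

ℕ→ℚ-+ : ∀ a b → ℕ→ℚ (a + b) ≡ ℕ→ℚ a +ℚ ℕ→ℚ b
ℕ→ℚ-+ a b = ℚP.toℚᵘ-injective
  (toℚᵘ-ℕ→ℚ (a + b) ⟨≃⟩ *≡* (identity (ℤ.+ a) (ℤ.+ b)) ⟨≃⟩
   ℚᵘP.≃-sym (ℚᵘP.+-cong (toℚᵘ-ℕ→ℚ a) (toℚᵘ-ℕ→ℚ b)) ⟨≃⟩ ℚᵘP.≃-sym (ℚP.toℚᵘ-homo-+ (ℕ→ℚ a) (ℕ→ℚ b)))
  where
  identity : ∀ (x y : ℤ) → (x ℤ.+ y) ℤ.* ℤ.+ 1 ≡ (x ℤ.* ℤ.+ 1 ℤ.+ y ℤ.* ℤ.+ 1) ℤ.* ℤ.+ 1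
  identity = ℤSolver.solve-∀

ℕ→ℚ-* : ∀ a b → ℕ→ℚ (a * b) ≡ ℕ→ℚ a *ℚ ℕ→ℚ b
ℕ→ℚ-* a b = ℚP.toℚᵘ-injective
  (toℚᵘ-ℕ→ℚ (a * b) ⟨≃⟩ *≡* (cong (ℤ._* ℤ.+ 1) (ℤP.pos-* a b)) ⟨≃⟩
   ℚᵘP.≃-sym (ℚᵘP.*-cong (toℚᵘ-ℕ→ℚ a) (toℚᵘ-ℕ→ℚ b)) ⟨≃⟩ ℚᵘP.≃-sym (ℚP.toℚᵘ-homo-* (ℕ→ℚ a) (ℕ→ℚ b)))

ℕ→ℚ-*-inv : ∀ d → ℕ→ℚ (suc d) *ℚ inv (suc d) ≡ 1ℚ
ℕ→ℚ-*-inv d = ℚP.toℚᵘ-injective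
  (ℚP.toℚᵘ-homo-* (ℕ→ℚ (suc d)) (inv (suc d)) ⟨≃⟩ ℚᵘP.*-cong (toℚᵘ-ℕ→ℚ (suc d)) (toℚᵘ-inv d) ⟨≃⟩
   *≡* (identity (ℤ.+ suc d)))
  where
  identity : ∀ (x : ℤ) → (x ℤ.* ℤ.+ 1) ℤ.* ℤ.+ 1 ≡ ℤ.+ 1 ℤ.* (ℤ.+ 1 ℤ.* x)
  identity = ℤSolver.solve-∀

ℕ→ℚ-mono-≤ : ∀ {a b} → a ≤ b → ℕ→ℚ a ≤ℚ ℕ→ℚ b
ℕ→ℚ-mono-≤ {a} {b} a≤b = ℚP.toℚᵘ-cancel-≤
  (ℚᵘP.≤-respʳ-≃ (ℚᵘP.≃-sym (toℚᵘ-ℕ→ℚ b)) (ℚᵘP.≤-respˡ-≃ (ℚᵘP.≃-sym (toℚᵘ-ℕ→ℚ a))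
    (*≤* (subst₂ ℤ._≤_ (sym (ℤP.*-identityʳ (ℤ.+ a))) (sym (ℤP.*-identityʳ (ℤ.+ b))) (+≤+ a≤b)))))

ℕ→ℚ-cancel-≤ : ∀ {a b} → ℕ→ℚ a ≤ℚ ℕ→ℚ b → a ≤ b
ℕ→ℚ-cancel-≤ {a} {b} le
  with *≤* le′ ← ℚᵘP.≤-respʳ-≃ (toℚᵘ-ℕ→ℚ b) (ℚᵘP.≤-respˡ-≃ (toℚᵘ-ℕ→ℚ a) (ℚP.toℚᵘ-mono-≤ le))
  with +≤+ a≤b ← subst₂ ℤ._≤_ (ℤP.*-identityʳ (ℤ.+ a)) (ℤP.*-identityʳ (ℤ.+ b)) le′
  = a≤b

ℕ→ℚ-nonNeg : ∀ k → 0ℚ ≤ℚ ℕ→ℚ k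
ℕ→ℚ-nonNeg k = ℕ→ℚ-mono-≤ {0} {k} z≤n

inv-nonNeg : ∀ k → 0ℚ ≤ℚ inv k
inv-nonNeg zero    = ℚP.≤-refl
inv-nonNeg (suc d) = ℚP.toℚᵘ-cancel-≤ (ℚᵘP.≤-respʳ-≃ (ℚᵘP.≃-sym (toℚᵘ-inv d))
  (*≤* (subst₂ ℤ._≤_ (sym (ℤP.*-zeroˡ (ℤ.+ suc d))) (sym (ℤP.*-identityʳ (ℤ.+ 1))) (+≤+ z≤n))))

*-monoˡ-≤-nonNeg : ∀ {r p q} → 0ℚ ≤ℚ r → p ≤ℚ q → r *ℚ p ≤ℚ r *ℚ q
*-monoˡ-≤-nonNeg {r} 0≤r = ℚP.*-monoˡ-≤-nonNeg r {{ℚ.nonNegative 0≤r}}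

*-monoʳ-≤-nonNeg : ∀ {r p q} → 0ℚ ≤ℚ r → p ≤ℚ q → p *ℚ r ≤ℚ q *ℚ r
*-monoʳ-≤-nonNeg {r} 0≤r = ℚP.*-monoʳ-≤-nonNeg r {{ℚ.nonNegative 0≤r}}

*-nonNeg : ∀ {p q} → 0ℚ ≤ℚ p → 0ℚ ≤ℚ q → 0ℚ ≤ℚ p *ℚ q
*-nonNeg {p} 0≤p 0≤q = ℚP.≤-trans (ℚP.≤-reflexive (sym (ℚP.*-zeroʳ p))) (*-monoˡ-≤-nonNeg 0≤p 0≤q)

inv-≤-* : ∀ a b k → suc a ≤ k * suc b → inv (suc b) ≤ℚ ℕ→ℚ k *ℚ inv (suc a)
inv-≤-* a b k le = begin
  inv (suc b)                                       ≡⟨ sym (ℚP.*-identityʳ _) ⟩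
  inv (suc b) *ℚ 1ℚ                                 ≡⟨ cong (inv (suc b) *ℚ_) (sym (ℕ→ℚ-*-inv a)) ⟩
  inv (suc b) *ℚ (ℕ→ℚ (suc a) *ℚ inv (suc a))       ≡⟨ reassoc (inv (suc b)) (ℕ→ℚ (suc a)) (inv (suc a)) ⟩
  (ℕ→ℚ (suc a) *ℚ inv (suc b)) *ℚ inv (suc a)       ≤⟨ *-monoʳ-≤-nonNeg (inv-nonNeg (suc a))
                                                         (*-monoʳ-≤-nonNeg (inv-nonNeg (suc b)) (ℕ→ℚ-mono-≤ le)) ⟩
  (ℕ→ℚ (k * suc b) *ℚ inv (suc b)) *ℚ inv (suc a)   ≡⟨ cong (λ z → (z *ℚ inv (suc b)) *ℚ inv (suc a)) (ℕ→ℚ-* k (suc b)) ⟩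
  ((ℕ→ℚ k *ℚ ℕ→ℚ (suc b)) *ℚ inv (suc b)) *ℚ inv (suc a)
                                                    ≡⟨ cong (_*ℚ inv (suc a)) (ℚP.*-assoc (ℕ→ℚ k) _ _) ⟩
  (ℕ→ℚ k *ℚ (ℕ→ℚ (suc b) *ℚ inv (suc b))) *ℚ inv (suc a)
                                                    ≡⟨ cong (λ z → (ℕ→ℚ k *ℚ z) *ℚ inv (suc a)) (ℕ→ℚ-*-inv b) ⟩
  (ℕ→ℚ k *ℚ 1ℚ) *ℚ inv (suc a)                      ≡⟨ cong (_*ℚ inv (suc a)) (ℚP.*-identityʳ (ℕ→ℚ k)) ⟩
  ℕ→ℚ k *ℚ inv (suc a)                              ∎
  where
  open ℚP.≤-Reasoning
  open +-*-Solver
  reassoc : ∀ x y z → x *ℚ (y *ℚ z) ≡ (y *ℚ x) *ℚ z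
  reassoc = solve 3 (λ x y z → x :* (y :* z) := (y :* x) :* z) refl

inv-antitone : ∀ {a b} → a ≤ b → inv (suc b) ≤ℚ inv (suc a)
inv-antitone {a} {b} a≤b =
  ℚP.≤-trans (inv-≤-* a b 1 (s≤s (≤-trans a≤b (≤-reflexive (sym (+-identityʳ b))))))
             (ℚP.≤-reflexive (ℚP.*-identityˡ (inv (suc a))))

*≤⇒≤*inv : ∀ L c N → suc L * c ≤ N → ℕ→ℚ c ≤ℚ ℕ→ℚ N *ℚ inv (suc L)
*≤⇒≤*inv L c N le = begin
  ℕ→ℚ c                                       ≡⟨ sym (ℚP.*-identityʳ _) ⟩
  ℕ→ℚ c *ℚ 1ℚ                                 ≡⟨ cong (ℕ→ℚ c *ℚ_) (sym (ℕ→ℚ-*-inv L)) ⟩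
  ℕ→ℚ c *ℚ (ℕ→ℚ (suc L) *ℚ inv (suc L))       ≡⟨ reassoc (ℕ→ℚ c) (ℕ→ℚ (suc L)) (inv (suc L)) ⟩
  (ℕ→ℚ (suc L) *ℚ ℕ→ℚ c) *ℚ inv (suc L)       ≡⟨ cong (_*ℚ inv (suc L)) (sym (ℕ→ℚ-* (suc L) c)) ⟩
  ℕ→ℚ (suc L * c) *ℚ inv (suc L)              ≤⟨ *-monoʳ-≤-nonNeg (inv-nonNeg (suc L)) (ℕ→ℚ-mono-≤ le) ⟩
  ℕ→ℚ N *ℚ inv (suc L)                        ∎
  where
  open ℚP.≤-Reasoning
  open +-*-Solver
  reassoc : ∀ x y z → x *ℚ (y *ℚ z) ≡ (y *ℚ x) *ℚ z
  reassoc = solve 3 (λ x y z → x :* (y :* z) := (y :* x) :* z) refl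

module _ {A : Set} where

  ∑ℚ-mono-≤ : ∀ xs {f g : A → ℚ} → (∀ {x} → x ∈ xs → f x ≤ℚ g x) → ∑ℚ xs f ≤ℚ ∑ℚ xs g
  ∑ℚ-mono-≤ []       le = ℚP.≤-refl
  ∑ℚ-mono-≤ (x ∷ xs) le = ℚP.+-mono-≤ (le (here refl)) (∑ℚ-mono-≤ xs (le ∘ there))

  ∑ℚ-nonNeg : ∀ xs {f : A → ℚ} → (∀ x → 0ℚ ≤ℚ f x) → 0ℚ ≤ℚ ∑ℚ xs f
  ∑ℚ-nonNeg []       _   = ℚP.≤-refl
  ∑ℚ-nonNeg (x ∷ xs) 0≤f = ℚP.+-mono-≤ (0≤f x) (∑ℚ-nonNeg xs 0≤f)

  ≤-∑ℚ : ∀ {xs} {f : A → ℚ} → (∀ x → 0ℚ ≤ℚ f x) → ∀ {x} → x ∈ xs → f x ≤ℚ ∑ℚ xs f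
  ≤-∑ℚ {y ∷ xs} {f} 0≤f (here refl) =
    ℚP.≤-trans (ℚP.≤-reflexive (sym (ℚP.+-identityʳ (f y)))) (ℚP.+-monoʳ-≤ (f y) (∑ℚ-nonNeg xs 0≤f))
  ≤-∑ℚ {y ∷ xs} {f} 0≤f (there x∈) =
    ℚP.≤-trans (≤-∑ℚ 0≤f x∈) (ℚP.≤-trans (ℚP.≤-reflexive (sym (ℚP.+-identityˡ _))) (ℚP.+-monoˡ-≤ (∑ℚ xs f) (0≤f y)))

  ∑ℚ-ℕ→ℚ : ∀ xs (f : A → ℕ) → ∑ℚ xs (ℕ→ℚ ∘ f) ≡ ℕ→ℚ (∑ xs f)
  ∑ℚ-ℕ→ℚ []       f = refl
  ∑ℚ-ℕ→ℚ (x ∷ xs) f = trans (cong (ℕ→ℚ (f x) +ℚ_) (∑ℚ-ℕ→ℚ xs f)) (sym (ℕ→ℚ-+ (f x) (∑ xs f)))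

  ∑ℚ-const : ∀ (xs : List A) c → ∑ℚ xs (const c) ≡ ℕ→ℚ (length xs) *ℚ c
  ∑ℚ-const xs c = begin
    ∑ℚ xs (const c)                     ≡⟨ ℚ∑.∑-≗ xs (λ _ → sym (ℚP.*-identityˡ c)) ⟩
    ∑ℚ xs (λ _ → ℕ→ℚ 1 *ℚ c)           ≡⟨ ℚ∑.∑-*ʳ xs c (const (ℕ→ℚ 1)) ⟩
    ∑ℚ xs (const (ℕ→ℚ 1)) *ℚ c         ≡⟨ cong (_*ℚ c) (trans (∑ℚ-ℕ→ℚ xs (const 1)) (cong ℕ→ℚ (∑-1 xs))) ⟩
    ℕ→ℚ (length xs) *ℚ c               ∎
    where open ≡-Reasoning

module NatMult = Multiplicity ℕ._≟_

∑ℚ-δ : ∀ rs t (h : ℕ → ℚ) → ∑ℚ rs (λ r → ℕ→ℚ (NatMult.δ r t) *ℚ h r) ≡ ℕ→ℚ (NatMult.mult t rs) *ℚ h t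
∑ℚ-δ rs t h = begin
  ∑ℚ rs (λ r → ℕ→ℚ (NatMult.δ r t) *ℚ h r)   ≡⟨ ℚ∑.∑-≗ rs δ-subst ⟩
  ∑ℚ rs (λ r → ℕ→ℚ (NatMult.δ r t) *ℚ h t)   ≡⟨ ℚ∑.∑-*ʳ rs (h t) (λ r → ℕ→ℚ (NatMult.δ r t)) ⟩
  ∑ℚ rs (λ r → ℕ→ℚ (NatMult.δ r t)) *ℚ h t   ≡⟨ cong (_*ℚ h t) (∑ℚ-ℕ→ℚ rs (λ r → NatMult.δ r t)) ⟩
  ℕ→ℚ (NatMult.mult t rs) *ℚ h t             ∎
  where
  open ≡-Reasoning
  δ-subst : ∀ r → ℕ→ℚ (NatMult.δ r t) *ℚ h r ≡ ℕ→ℚ (NatMult.δ r t) *ℚ h t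
  δ-subst r with NatMult.δ-cases r t
  ... | inj₁ (refl , _)  = refl
  ... | inj₂ (_ , δ≡0) rewrite δ≡0 = trans (ℚP.*-zeroˡ (h r)) (sym (ℚP.*-zeroˡ (h t)))

∑ℚ-by-value : ∀ {A : Set} xs (p : A → Bool) (g : A → ℕ) (f : ℕ → ℚ) D → (∀ {x} → T (p x) → g x < D) →
              ∑ℚ (filterᵇ p xs) (f ∘ g) ≡ ∑ℚ (downFrom D) (λ r → ℕ→ℚ (∑ xs (λ x → 𝟙 (p x) * NatMult.δ r (g x))) *ℚ f r)
∑ℚ-by-value xs p g f D g<D = begin
  ∑ℚ (filterᵇ p xs) (f ∘ g)
    ≡⟨ ℚ∑.∑-filterᵇ p xs (f ∘ g) ⟩
  ∑ℚ xs (λ x → if p x then f (g x) else 0ℚ)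
    ≡⟨ ℚ∑.∑-≗ xs (λ x → spread x (p x) refl) ⟩
  ∑ℚ xs (λ x → ∑ℚ (downFrom D) (λ r → ℕ→ℚ (𝟙 (p x) * NatMult.δ r (g x)) *ℚ f r))
    ≡⟨ ℚ∑.∑-comm xs (downFrom D) _ ⟩
  ∑ℚ (downFrom D) (λ r → ∑ℚ xs (λ x → ℕ→ℚ (𝟙 (p x) * NatMult.δ r (g x)) *ℚ f r))
    ≡⟨ ℚ∑.∑-≗ (downFrom D) (λ r → trans (ℚ∑.∑-*ʳ xs (f r) _) (cong (_*ℚ f r) (∑ℚ-ℕ→ℚ xs _))) ⟩
  ∑ℚ (downFrom D) (λ r → ℕ→ℚ (∑ xs (λ x → 𝟙 (p x) * NatMult.δ r (g x))) *ℚ f r)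
    ∎
  where
  open ≡-Reasoning
  spread : ∀ x b → p x ≡ b → (if b then f (g x) else 0ℚ) ≡ ∑ℚ (downFrom D) (λ r → ℕ→ℚ (𝟙 b * NatMult.δ r (g x)) *ℚ f r)
  spread x false _  = sym (trans (ℚ∑.∑-≗ (downFrom D) (λ r → ℚP.*-zeroˡ (f r))) (ℚ∑.∑-zero (downFrom D)))
  spread x true  px = sym (begin
    ∑ℚ (downFrom D) (λ r → ℕ→ℚ (1 * NatMult.δ r (g x)) *ℚ f r)
      ≡⟨ ℚ∑.∑-≗ (downFrom D) (λ r → cong (λ k → ℕ→ℚ k *ℚ f r) (*-identityˡ (NatMult.δ r (g x)))) ⟩
    ∑ℚ (downFrom D) (λ r → ℕ→ℚ (NatMult.δ r (g x)) *ℚ f r)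
      ≡⟨ ∑ℚ-δ (downFrom D) (g x) f ⟩
    ℕ→ℚ (NatMult.mult (g x) (downFrom D)) *ℚ f (g x)
      ≡⟨ cong (λ k → ℕ→ℚ k *ℚ f (g x)) (NatMult.mult-unique-∈ (downFrom⁺ D) (∈-downFrom⁺ (g<D (Equivalence.from T-≡ px)))) ⟩
    ℕ→ℚ 1 *ℚ f (g x)
      ≡⟨ ℚP.*-identityˡ (f (g x)) ⟩
    f (g x) ∎)

H : ℕ → ℚ
H zero    = 0ℚ
H (suc k) = H k +ℚ inv (suc k)

∑ℚ-downFrom-inv : ∀ D → ∑ℚ (downFrom D) inv ≡ H (D ∸ 1)
∑ℚ-downFrom-inv zero          = refl
∑ℚ-downFrom-inv (suc zero)    = ℚP.+-identityʳ 0ℚ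
∑ℚ-downFrom-inv (suc (suc B)) =
  trans (ℚP.+-comm (inv (suc B)) _) (cong (_+ℚ inv (suc B)) (∑ℚ-downFrom-inv (suc B)))

H-+ : ∀ h c → H (h + c) ≤ℚ H h +ℚ ℕ→ℚ c *ℚ inv (suc h)
H-+ h zero = ℚP.≤-reflexive (begin
  H (h + 0)                     ≡⟨ cong H (+-identityʳ h) ⟩
  H h                           ≡⟨ sym (ℚP.+-identityʳ (H h)) ⟩
  H h +ℚ 0ℚ                     ≡⟨ cong (H h +ℚ_) (sym (ℚP.*-zeroˡ (inv (suc h)))) ⟩
  H h +ℚ 0ℚ *ℚ inv (suc h)      ∎)
  where open ≡-Reasoning
H-+ h (suc c) = begin
  H (h + suc c)                                       ≡⟨ cong H (+-suc h c) ⟩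
  H (h + c) +ℚ inv (suc (h + c))                      ≤⟨ ℚP.+-mono-≤ (H-+ h c) (inv-antitone (m≤m+n h c)) ⟩
  (H h +ℚ ℕ→ℚ c *ℚ inv (suc h)) +ℚ inv (suc h)        ≡⟨ ℚP.+-assoc (H h) _ _ ⟩
  H h +ℚ (ℕ→ℚ c *ℚ inv (suc h) +ℚ inv (suc h))        ≡⟨ cong (H h +ℚ_) collect ⟩
  H h +ℚ ℕ→ℚ (suc c) *ℚ inv (suc h)                   ∎
  where
  open ℚP.≤-Reasoning
  collect : ℕ→ℚ c *ℚ inv (suc h) +ℚ inv (suc h) ≡ ℕ→ℚ (suc c) *ℚ inv (suc h)
  collect = begin-equality
    ℕ→ℚ c *ℚ inv (suc h) +ℚ inv (suc h)            ≡⟨ cong (ℕ→ℚ c *ℚ inv (suc h) +ℚ_) (sym (ℚP.*-identityˡ _)) ⟩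
    ℕ→ℚ c *ℚ inv (suc h) +ℚ ℕ→ℚ 1 *ℚ inv (suc h)   ≡⟨ sym (ℚP.*-distribʳ-+ (inv (suc h)) (ℕ→ℚ c) (ℕ→ℚ 1)) ⟩
    (ℕ→ℚ c +ℚ ℕ→ℚ 1) *ℚ inv (suc h)               ≡⟨ cong (_*ℚ inv (suc h)) (sym (ℕ→ℚ-+ c 1)) ⟩
    ℕ→ℚ (c + 1) *ℚ inv (suc h)                     ≡⟨ cong (λ z → ℕ→ℚ z *ℚ inv (suc h)) (+-comm c 1) ⟩
    ℕ→ℚ (suc c) *ℚ inv (suc h)                     ∎

⌈n/2⌉≤1+⌊n/2⌋ : ∀ n → ⌈ n /2⌉ ≤ suc ⌊ n /2⌋
⌈n/2⌉≤1+⌊n/2⌋ zero          = z≤n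
⌈n/2⌉≤1+⌊n/2⌋ (suc zero)    = s≤s z≤n
⌈n/2⌉≤1+⌊n/2⌋ (suc (suc n)) = s≤s (⌈n/2⌉≤1+⌊n/2⌋ n)

-- The terms from ⌊N/2⌋+1 to N are at most ⌊N/2⌋+1 in number, each at most 1/(⌊N/2⌋+1).
H-≤-H-half : ∀ N → H N ≤ℚ H ⌊ N /2⌋ +ℚ 1ℚ
H-≤-H-half N = begin
  H N                                   ≡⟨ cong H (sym (⌊n/2⌋+⌈n/2⌉≡n N)) ⟩
  H (h + ⌈ N /2⌉)                       ≤⟨ H-+ h ⌈ N /2⌉ ⟩
  H h +ℚ ℕ→ℚ ⌈ N /2⌉ *ℚ inv (suc h)     ≤⟨ ℚP.+-monoʳ-≤ (H h) (*-monoʳ-≤-nonNeg (inv-nonNeg (suc h))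
                                                              (ℕ→ℚ-mono-≤ (⌈n/2⌉≤1+⌊n/2⌋ N))) ⟩
  H h +ℚ ℕ→ℚ (suc h) *ℚ inv (suc h)     ≡⟨ cong (H h +ℚ_) (ℕ→ℚ-*-inv h) ⟩
  H h +ℚ 1ℚ                             ∎
  where
  open ℚP.≤-Reasoning
  h = ⌊ N /2⌋

suc-⌊log₂⌊n/2⌋⌋ : ∀ n → 2 ≤ n → suc ⌊log₂ ⌊ n /2⌋ ⌋ ≡ ⌊log₂ n ⌋
suc-⌊log₂⌊n/2⌋⌋ n 2≤n with ⌊log₂ n ⌋ | ⌊log₂⌊n/2⌋⌋≡⌊log₂n⌋∸1 n | ⌊log₂⌋-mono-≤ {2} {n} 2≤n
... | zero  | _  | ()
... | suc L | eq | _  = cong suc eq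

H-≤-1+log₂ : ∀ N → 1 ≤ N → H N ≤ℚ ℕ→ℚ (suc ⌊log₂ N ⌋)
H-≤-1+log₂ k = go k (<-wellFounded k)
  where
  go : ∀ N → Acc _<_ N → 1 ≤ N → H N ≤ℚ ℕ→ℚ (suc ⌊log₂ N ⌋)
  go (suc zero)    _        _ = ℚP.≤-trans (ℚP.≤-reflexive (ℚP.+-identityˡ (inv 1))) (ℕ→ℚ-mono-≤ {1} {1} ≤-refl)
  go (suc (suc n)) (acc rs) _ = begin
    H N                               ≤⟨ H-≤-H-half N ⟩
    H ⌊ N /2⌋ +ℚ 1ℚ                   ≤⟨ ℚP.+-monoˡ-≤ 1ℚ (go ⌊ N /2⌋ (rs (⌊n/2⌋<n (suc n))) (s≤s z≤n)) ⟩
    ℕ→ℚ (suc ⌊log₂ ⌊ N /2⌋ ⌋) +ℚ ℕ→ℚ 1 ≡⟨ sym (ℕ→ℚ-+ (suc ⌊log₂ ⌊ N /2⌋ ⌋) 1) ⟩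
    ℕ→ℚ (suc ⌊log₂ ⌊ N /2⌋ ⌋ + 1)     ≡⟨ cong ℕ→ℚ (+-comm (suc ⌊log₂ ⌊ N /2⌋ ⌋) 1) ⟩
    ℕ→ℚ (suc (suc ⌊log₂ ⌊ N /2⌋ ⌋))   ≡⟨ cong (ℕ→ℚ ∘ suc) (suc-⌊log₂⌊n/2⌋⌋ N (s≤s (s≤s z≤n))) ⟩
    ℕ→ℚ (suc ⌊log₂ N ⌋)               ∎
    where
    open ℚP.≤-Reasoning
    N = suc (suc n)

1+m≤2*n : ∀ {m n} → m ≤ n → 1 ≤ n → suc m ≤ 2 * n
1+m≤2*n {m} {n} m≤n 1≤n = subst (suc m ≤_) (cong (n +_) (sym (+-identityʳ n))) (+-mono-≤ 1≤n m≤n)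

H-≤-2log₂ : ∀ D → H (D ∸ 1) ≤ℚ ℕ→ℚ (2 * ⌊log₂ D ⌋)
H-≤-2log₂ zero          = ℕ→ℚ-nonNeg 0
H-≤-2log₂ (suc zero)    = ℕ→ℚ-nonNeg 0
H-≤-2log₂ (suc (suc d)) = ℚP.≤-trans (H-≤-1+log₂ (suc d) (s≤s z≤n))
  (ℕ→ℚ-mono-≤ (1+m≤2*n (⌊log₂⌋-mono-≤ (n≤1+n (suc d))) (⌊log₂⌋-mono-≤ {2} {suc (suc d)} (s≤s (s≤s z≤n)))))

module _ {A : Set} where

  length≡∑𝟙+∑𝟙not : ∀ (p : A → Bool) xs → length xs ≡ ∑ xs (𝟙 ∘ p) + ∑ xs (𝟙 ∘ not ∘ p)
  length≡∑𝟙+∑𝟙not p xs =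
    trans (sym (∑-1 xs)) (trans (∑-≗ xs (split ∘ p)) (∑-distrib-+ xs (𝟙 ∘ p) (𝟙 ∘ not ∘ p)))
    where
    split : ∀ b → 1 ≡ 𝟙 b + 𝟙 (not b)
    split true  = refl
    split false = refl

  count-exceeding*t≤∑ : ∀ xs (f : A → ℚ) t → (∀ x → 0ℚ ≤ℚ f x) →
                      ℕ→ℚ (∑ xs (𝟙 ∘ not ∘ (λ x → f x ≤ᵇ t))) *ℚ t ≤ℚ ∑ℚ xs f
  count-exceeding*t≤∑ xs f t 0≤f = begin
    ℕ→ℚ (∑ xs (𝟙 ∘ not ∘ good)) *ℚ t           ≡⟨ cong (_*ℚ t) (sym (∑ℚ-ℕ→ℚ xs (𝟙 ∘ not ∘ good))) ⟩
    ∑ℚ xs (ℕ→ℚ ∘ 𝟙 ∘ not ∘ good) *ℚ t          ≡⟨ sym (ℚ∑.∑-*ʳ xs t (ℕ→ℚ ∘ 𝟙 ∘ not ∘ good)) ⟩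
    ∑ℚ xs (λ x → ℕ→ℚ (𝟙 (not (good x))) *ℚ t) ≤⟨ ∑ℚ-mono-≤ xs (λ {x} _ → exceeding-≤ x) ⟩
    ∑ℚ xs f                                    ∎
    where
    open ℚP.≤-Reasoning
    good = λ x → f x ≤ᵇ t
    exceeding-≤ : ∀ x → ℕ→ℚ (𝟙 (not (good x))) *ℚ t ≤ℚ f x
    exceeding-≤ x with good x in gx
    ... | true  = ℚP.≤-trans (ℚP.≤-reflexive (ℚP.*-zeroˡ t)) (0≤f x)
    ... | false = ℚP.≤-trans (ℚP.≤-reflexive (ℚP.*-identityˡ t))
                    (ℚP.<⇒≤ (ℚP.≰⇒> (λ f≤t → subst T gx (ℚP.≤⇒≤ᵇ f≤t))))

m≡n+o⇒2o≤m⇒m≤2n : ∀ {N G B} → N ≡ G + B → 2 * B ≤ N → N ≤ 2 * G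
m≡n+o⇒2o≤m⇒m≤2n {N} {G} {B} refl 2B≤N = begin
  G + B      ≤⟨ +-monoʳ-≤ G B≤G ⟩
  G + G      ≡⟨ cong (G +_) (sym (+-identityʳ G)) ⟩
  2 * G      ∎
  where
  open ≤-Reasoning
  B≤G : B ≤ G
  B≤G = +-cancelʳ-≤ B B G (subst (_≤ G + B) (cong (B +_) (+-identityʳ B)) 2B≤N)

markov : ∀ {A : Set} xs (f : A → ℚ) c → (∀ x → 0ℚ ≤ℚ f x) → 0ℚ ≤ℚ c → ∑ℚ xs f ≤ℚ ℕ→ℚ (length xs) *ℚ c →
         length xs ≤ 2 * length (filterᵇ (λ x → f x ≤ᵇ ℕ→ℚ 2 *ℚ c) xs)
markov xs f c 0≤f 0≤c ∑f≤Nc with ℚP.<-cmp 0ℚ c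
... | tri> _ _ c<0 = ⊥-elim (ℚP.<-irrefl refl (ℚP.<-≤-trans c<0 0≤c))
... | tri≈ _ refl _ =
  subst (λ ys → length xs ≤ 2 * length ys) (sym (filter-all (T? ∘ good) (All.tabulate all-good))) (m≤m+n _ _)
  where
  good = λ x → f x ≤ᵇ ℕ→ℚ 2 *ℚ 0ℚ
  all-good : ∀ {x} → x ∈ xs → T (good x)
  all-good x∈ = ℚP.≤⇒≤ᵇ (ℚP.≤-trans (≤-∑ℚ 0≤f x∈)
                 (ℚP.≤-trans ∑f≤Nc (ℚP.≤-reflexive (trans (ℚP.*-zeroʳ (ℕ→ℚ (length xs))) (sym (ℚP.*-zeroʳ (ℕ→ℚ 2)))))))
... | tri< 0<c _ _ =
  subst (λ G → length xs ≤ 2 * G) (sym (length-filterᵇ good xs))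
        (m≡n+o⇒2o≤m⇒m≤2n {G = ∑ xs (𝟙 ∘ good)} (length≡∑𝟙+∑𝟙not good xs) 2B≤N)
  where
  good = λ x → f x ≤ᵇ ℕ→ℚ 2 *ℚ c
  B = ∑ xs (𝟙 ∘ not ∘ good)
  2B*c≤N*c : ℕ→ℚ (2 * B) *ℚ c ≤ℚ ℕ→ℚ (length xs) *ℚ c
  2B*c≤N*c = begin
    ℕ→ℚ (2 * B) *ℚ c           ≡⟨ cong (_*ℚ c) (ℕ→ℚ-* 2 B) ⟩
    (ℕ→ℚ 2 *ℚ ℕ→ℚ B) *ℚ c      ≡⟨ swap (ℕ→ℚ 2) (ℕ→ℚ B) c ⟩
    ℕ→ℚ B *ℚ (ℕ→ℚ 2 *ℚ c)      ≤⟨ count-exceeding*t≤∑ xs f (ℕ→ℚ 2 *ℚ c) 0≤f ⟩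
    ∑ℚ xs f                    ≤⟨ ∑f≤Nc ⟩
    ℕ→ℚ (length xs) *ℚ c       ∎
    where
    open ℚP.≤-Reasoning
    open +-*-Solver
    swap : ∀ a b q → (a *ℚ b) *ℚ q ≡ b *ℚ (a *ℚ q)
    swap = solve 3 (λ a b q → (a :* b) :* q := b :* (a :* q)) refl
  2B≤N : 2 * B ≤ length xs
  2B≤N = ℕ→ℚ-cancel-≤ (ℚP.*-cancelʳ-≤-pos c {{ℚ.positive 0<c}} 2B*c≤N*c)

-- Random rankings

T-injective : ∀ {x y : Bool} → (T x → T y) → (T y → T x) → x ≡ y
T-injective {false} {false} _ _ = refl
T-injective {false} {true}  _ g = ⊥-elim (g tt)
T-injective {true}  {false} f _ = ⊥-elim (f tt)
T-injective {true}  {true}  _ _ = refl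

module _ {P Q : Set} where

  T-⌊⌋-∨-not⁻ : (P? : Dec P) (Q? : Dec Q) → T (⌊ P? ⌋ ∨ not ⌊ Q? ⌋) → Q → P
  T-⌊⌋-∨-not⁻ (yes p) _       _  _ = p
  T-⌊⌋-∨-not⁻ (no ¬p) (no ¬q) _  q = ⊥-elim (¬q q)

  T-⌊⌋-∨-not⁺ : (P? : Dec P) (Q? : Dec Q) → (Q → P) → T (⌊ P? ⌋ ∨ not ⌊ Q? ⌋)
  T-⌊⌋-∨-not⁺ (yes _) _       _   = tt
  T-⌊⌋-∨-not⁺ (no ¬p) (yes q) q→p = ⊥-elim (¬p (q→p q))
  T-⌊⌋-∨-not⁺ (no _)  (no _)  _   = tt

module FinMult {n : ℕ} = Multiplicity (_≟ᶠ_ {n})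
module VecMult {b a : ℕ} = Multiplicity (≡-decᵥ {n = a} (_≟ᶠ_ {b}))

mult-allFin : ∀ {n} (z : Fin n) → FinMult.mult z (allFin n) ≡ 1
mult-allFin {n} z = FinMult.mult-unique-∈ (allFin⁺ n) (∈-allFin z)

δ-∷ : ∀ {b a} (i j : Fin b) (w v : Vec (Fin b) a) → VecMult.δ (i ∷ᵥ w) (j ∷ᵥ v) ≡ FinMult.δ i j * VecMult.δ w v
δ-∷ i j w v with VecMult.δ-cases (i ∷ᵥ w) (j ∷ᵥ v)
... | inj₁ (refl , eq) rewrite eq | FinMult.δ-refl i | VecMult.δ-refl w = refl
... | inj₂ (i∷w≢j∷v , eq) rewrite eq with FinMult.δ-cases i j | VecMult.δ-cases w v
...   | inj₁ (refl , _) | inj₁ (refl , _) = ⊥-elim (i∷w≢j∷v refl)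
...   | inj₁ (refl , _) | inj₂ (_ , eq′) rewrite eq′ = sym (*-zeroʳ (FinMult.δ i i))
...   | inj₂ (_ , eq′)  | _ rewrite eq′ = refl

mult-allVecs : ∀ b a (v : Vec (Fin b) a) → VecMult.mult v (allVecs b a) ≡ 1
mult-allVecs b zero    []ᵥ       = refl
mult-allVecs b (suc a) (j ∷ᵥ v) = begin
  VecMult.mult (j ∷ᵥ v) (allVecs b (suc a))
    ≡⟨ ∑-concatMap (allVecs b a) (λ w → map (_∷ᵥ w) (allFin b)) (λ x → VecMult.δ x (j ∷ᵥ v)) ⟩
  ∑ (allVecs b a) (λ w → ∑ (map (_∷ᵥ w) (allFin b)) (λ x → VecMult.δ x (j ∷ᵥ v)))
    ≡⟨ ∑-≗ (allVecs b a) heads ⟩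
  VecMult.mult v (allVecs b a)
    ≡⟨ mult-allVecs b a v ⟩
  1 ∎
  where
  open ≡-Reasoning
  heads : ∀ w → ∑ (map (_∷ᵥ w) (allFin b)) (λ x → VecMult.δ x (j ∷ᵥ v)) ≡ VecMult.δ w v
  heads w = begin
    ∑ (map (_∷ᵥ w) (allFin b)) (λ x → VecMult.δ x (j ∷ᵥ v))  ≡⟨ ∑-map (allFin b) (_∷ᵥ w) _ ⟩
    ∑ (allFin b) (λ i → VecMult.δ (i ∷ᵥ w) (j ∷ᵥ v))         ≡⟨ ∑-≗ (allFin b) (λ i → δ-∷ i j w v) ⟩
    ∑ (allFin b) (λ i → FinMult.δ i j * VecMult.δ w v)       ≡⟨ ∑-*ʳ (allFin b) (VecMult.δ w v) (λ i → FinMult.δ i j) ⟩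
    FinMult.mult j (allFin b) * VecMult.δ w v               ≡⟨ cong (_* VecMult.δ w v) (mult-allFin j) ⟩
    1 * VecMult.δ w v                                       ≡⟨ *-identityˡ _ ⟩
    VecMult.δ w v                                           ∎

module _ {X : Set} {M : ℕ} where

  permute : (Fin M → Fin M) → Vec X M → Vec X M
  permute π ρ = Vec.tabulate (lookup ρ ∘ π)

  lookup-permute : ∀ π ρ i → lookup (permute π ρ) i ≡ lookup ρ (π i)
  lookup-permute π ρ = lookup∘tabulate (lookup ρ ∘ π)

  permute-injective : ∀ {π π′} → (∀ i → π′ (π i) ≡ i) →
                      ∀ ρ → Injective _≡_ _≡_ (lookup ρ) → Injective _≡_ _≡_ (lookup (permute π ρ))
  permute-injective {π} {π′} π′π ρ inj {i} {j} eq = begin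
    i            ≡⟨ sym (π′π i) ⟩
    π′ (π i)     ≡⟨ cong π′ (inj (trans (sym (lookup-permute π ρ i)) (trans eq (lookup-permute π ρ j)))) ⟩
    π′ (π j)     ≡⟨ π′π j ⟩
    j            ∎
    where open ≡-Reasoning

  permute-inverse : ∀ {π π′} → (∀ i → π (π′ i) ≡ i) → ∀ ρ → permute π′ (permute π ρ) ≡ ρ
  permute-inverse {π} {π′} ππ′ ρ =
    trans (tabulate-cong (λ i → trans (lookup-permute π ρ (π′ i)) (cong (lookup ρ) (ππ′ i)))) (tabulate∘lookup ρ)

module _ {M : ℕ} where

  transpose-left : ∀ (a b : Fin M) → PC.transpose a b a ≡ b
  transpose-left a b rewrite dec-true (a ≟ᶠ a) refl = refl

  transpose-∈ : ∀ {a b c} {A : List (Fin M)} → a ∈ A → b ∈ A → c ∈ A → PC.transpose a b c ∈ A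
  transpose-∈ {a} {b} {c} a∈ b∈ c∈ with does (c ≟ᶠ a)
  ... | true  = b∈
  ... | false with does (c ≟ᶠ b)
  ...   | true  = a∈
  ...   | false = c∈

  isMinᵇ : (Fin M → Fin M) → Fin M → List (Fin M) → Bool
  isMinᵇ ρ a A = all (λ c → toℕ (ρ a) ℕ.≤ᵇ toℕ (ρ c)) A

  isMin⁻ : ∀ ρ {a A} → T (isMinᵇ ρ a A) → ∀ {c} → c ∈ A → toℕ (ρ a) ≤ toℕ (ρ c)
  isMin⁻ ρ {a} {A} t c∈ = ≤ᵇ⇒≤ _ _ (All.lookup (all⁺ (λ c → toℕ (ρ a) ℕ.≤ᵇ toℕ (ρ c)) A t) c∈)

  isMin⁺ : ∀ ρ {a A} → (∀ {c} → c ∈ A → toℕ (ρ a) ≤ toℕ (ρ c)) → T (isMinᵇ ρ a A)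
  isMin⁺ ρ {a} min = all⁻ (λ c → toℕ (ρ a) ℕ.≤ᵇ toℕ (ρ c)) (All.tabulate (≤⇒≤ᵇ ∘ min))

  isMinᵇ-cong : ∀ {f g} → (∀ x → f x ≡ g x) → ∀ a A → isMinᵇ f a A ≡ isMinᵇ g a A
  isMinᵇ-cong f≗g a []      = refl
  isMinᵇ-cong f≗g a (c ∷ A) = cong₂ _∧_ (cong₂ (λ x y → toℕ x ℕ.≤ᵇ toℕ y) (f≗g a) (f≗g c)) (isMinᵇ-cong f≗g a A)

  isMinᵇ-transpose : ∀ ρ {a b A} → a ∈ A → b ∈ A → isMinᵇ (ρ ∘ PC.transpose a b) a A ≡ isMinᵇ ρ b A
  isMinᵇ-transpose ρ {a} {b} {A} a∈ b∈ = T-injective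
    (λ t → isMin⁺ ρ {a = b} (λ {c} c∈ →
      subst₂ (λ x y → toℕ (ρ x) ≤ toℕ (ρ y)) (transpose-left a b) (PC.transpose-inverse a b)
             (isMin⁻ (ρ ∘ PC.transpose a b) {a = a} t (transpose-∈ b∈ a∈ c∈))))
    (λ t → isMin⁺ (ρ ∘ PC.transpose a b) {a = a} (λ {c} c∈ →
      subst (λ x → toℕ (ρ x) ≤ toℕ (ρ (PC.transpose a b c))) (sym (transpose-left a b))
            (isMin⁻ ρ {a = b} t (transpose-∈ a∈ b∈ c∈))))

module Rankings (R : Raw) where
  open RawOps R

  private
    distinct-at : Vec (Fin M) M → Fin M → Fin M → Bool
    distinct-at v i j = ⌊ i ≟ᶠ j ⌋ ∨ not ⌊ lookup v i ≟ᶠ lookup v j ⌋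

  injᵇ-sound : ∀ v → T (injᵇ v) → Injective _≡_ _≡_ (lookup v)
  injᵇ-sound v t {i} {j} = T-⌊⌋-∨-not⁻ (i ≟ᶠ j) (lookup v i ≟ᶠ lookup v j)
    (All.lookup (all⁺ (distinct-at v i) (allFin M)
      (All.lookup (all⁺ (λ i → all (distinct-at v i) (allFin M)) (allFin M) t) (∈-allFin i))) (∈-allFin j))

  injᵇ-complete : ∀ v → Injective _≡_ _≡_ (lookup v) → T (injᵇ v)
  injᵇ-complete v inj = all⁻ (λ i → all (distinct-at v i) (allFin M)) {xs = allFin M} (All.tabulate (λ {i} _ →
    all⁻ (distinct-at v i) {xs = allFin M} (All.tabulate (λ {j} _ → T-⌊⌋-∨-not⁺ (i ≟ᶠ j) (lookup v i ≟ᶠ lookup v j) inj))))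

  ∈-rankings⇒injective : ∀ {ρ} → ρ ∈ rankings → Injective _≡_ _≡_ (lookup ρ)
  ∈-rankings⇒injective {ρ} ρ∈ = injᵇ-sound ρ (proj₂ (∈-filter⁻ (T? ∘ injᵇ) {xs = allVecs M M} ρ∈))

  module _ {π π′ : Fin M → Fin M} (ππ′ : ∀ i → π (π′ i) ≡ i) (π′π : ∀ i → π′ (π i) ≡ i) where

    injᵇ-permute : ∀ ρ → injᵇ (permute π ρ) ≡ injᵇ ρ
    injᵇ-permute ρ = T-injective
      (λ t → subst (T ∘ injᵇ) (permute-inverse ππ′ ρ)
               (injᵇ-complete (permute π′ (permute π ρ))
                 (permute-injective {π = π′} {π′ = π} ππ′ (permute π ρ) (injᵇ-sound (permute π ρ) t))))
      (λ t → injᵇ-complete (permute π ρ) (permute-injective {π = π} {π′ = π′} π′π ρ (injᵇ-sound ρ t)))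

    ∑-rankings-permute : (h : Vec (Fin M) M → ℕ) → ∑ rankings (h ∘ permute π) ≡ ∑ rankings h
    ∑-rankings-permute h = begin
      ∑ rankings (h ∘ permute π)                                 ≡⟨ ∑-filterᵇ injᵇ (allVecs M M) _ ⟩
      ∑ (allVecs M M) (λ ρ → if injᵇ ρ then h (permute π ρ) else 0)
        ≡⟨ ∑-≗ (allVecs M M) (λ ρ → cong (λ b → if b then h (permute π ρ) else 0) (sym (injᵇ-permute ρ))) ⟩
      ∑ (allVecs M M) (h′ ∘ permute π)
        ≡⟨ VecMult.∑-reindex (allVecs M M) (mult-allVecs M M) (permute π) (permute π′)
             (permute-inverse π′π) (permute-inverse ππ′) h′ ⟩
      ∑ (allVecs M M) h′                                         ≡⟨ sym (∑-filterᵇ injᵇ (allVecs M M) h) ⟩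
      ∑ rankings h                                               ∎
      where
      open ≡-Reasoning
      h′ : Vec (Fin M) M → ℕ
      h′ ρ = if injᵇ ρ then h ρ else 0

  minCount : Fin M → List (Fin M) → ℕ
  minCount a A = ∑ rankings (λ ρ → 𝟙 (isMinᵇ (lookup ρ) a A))

  minCount-transpose : ∀ {a b A} → a ∈ A → b ∈ A → minCount a A ≡ minCount b A
  minCount-transpose {a} {b} {A} a∈ b∈ = begin
    minCount a A
      ≡⟨ sym (∑-rankings-permute {π = PC.transpose a b} {π′ = PC.transpose b a}
               (λ _ → PC.transpose-inverse a b) (λ _ → PC.transpose-inverse b a) _) ⟩
    ∑ rankings (λ ρ → 𝟙 (isMinᵇ (lookup (permute (PC.transpose a b) ρ)) a A))
      ≡⟨ ∑-≗ rankings (λ ρ → cong 𝟙 (trans (isMinᵇ-cong (lookup-permute (PC.transpose a b) ρ) a A)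
                                             (isMinᵇ-transpose (lookup ρ) a∈ b∈))) ⟩
    minCount b A ∎
    where open ≡-Reasoning

  -- Summed over b ∈ A, the counts are at most one per ranking, and by symmetry they are all equal.
  length*minCount≤length-rankings : ∀ {A a} → Unique A → a ∈ A → length A * minCount a A ≤ length rankings
  length*minCount≤length-rankings {A} {a} uniq a∈ = begin
    length A * minCount a A                                ≡⟨ sym (∑-const A (minCount a A)) ⟩
    ∑ A (const (minCount a A))                             ≡⟨ ∑-cong A (minCount-transpose a∈) ⟩
    ∑ A (λ b → minCount b A)                               ≡⟨ ∑-comm A rankings _ ⟩
    ∑ rankings (λ ρ → ∑ A (λ b → 𝟙 (isMinᵇ (lookup ρ) b A))) ≤⟨ ∑-mono-≤ rankings at-most-one-min ⟩
    ∑ rankings (const 1)                                   ≡⟨ ∑-1 rankings ⟩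
    length rankings                                        ∎
    where
    open ≤-Reasoning
    at-most-one-min : ∀ {ρ} → ρ ∈ rankings → ∑ A (λ b → 𝟙 (isMinᵇ (lookup ρ) b A)) ≤ 1
    at-most-one-min {ρ} ρ∈ = FinMult.count-subsingleton A _ uniq (λ x∈ y∈ x-min y-min →
      ∈-rankings⇒injective ρ∈ (toℕ-injective (≤-antisym (isMin⁻ (lookup ρ) x-min y∈) (isMin⁻ (lookup ρ) y-min x∈))))

maxℕ-upper : ∀ {xs : List ℕ} {x} → x ∈ xs → x ≤ maxℕ xs
maxℕ-upper {y ∷ xs} (here refl) = m≤m⊔n y _
maxℕ-upper {y ∷ xs} (there x∈)  = ≤-trans (maxℕ-upper x∈) (m≤n⊔m y _)

maxℕ-attained : ∀ (xs : List ℕ) → maxℕ xs ≡ 0 ⊎ maxℕ xs ∈ xs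
maxℕ-attained []       = inj₁ refl
maxℕ-attained (y ∷ xs) with ⊔-sel y (maxℕ xs)
... | inj₁ eq = inj₂ (subst (_∈ y ∷ xs) (sym eq) (here refl))
... | inj₂ eq with maxℕ-attained xs
...   | inj₁ max≡0 = inj₁ (trans eq max≡0)
...   | inj₂ max∈  = inj₂ (subst (_∈ y ∷ xs) (sym eq) (there max∈))

maxℕ-least : ∀ (xs : List ℕ) {b} → (∀ {x} → x ∈ xs → x ≤ b) → maxℕ xs ≤ b
maxℕ-least []       _     = z≤n
maxℕ-least (y ∷ xs) upper = ⊔-lub (upper (here refl)) (maxℕ-least xs (upper ∘ there))

map-unique : ∀ {A B : Set} (f : A → B) {xs} → Unique xs →
             (∀ {a b} → a ∈ xs → b ∈ xs → f a ≡ f b → a ≡ b) → Unique (map f xs)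
map-unique f {[]}     _           _   = []
map-unique f {x ∷ xs} (x∉ ∷ uniq) inj =
  All-map⁺ (All.tabulate (λ {b} b∈ fx≡fb → All.lookup x∉ b∈ (inj (here refl) (there b∈) fx≡fb))) ∷
  map-unique f uniq (λ a∈ b∈ → inj (there a∈) (there b∈))

∸-∸≡∸+ : ∀ {k t d} → k ≤ t → t ≤ d → d ∸ (t ∸ k) ≡ (d ∸ t) + k
∸-∸≡∸+ {k} {t} {d} k≤t t≤d = begin
  d ∸ (t ∸ k)                                 ≡⟨ cong (_∸ (t ∸ k)) (sym split) ⟩
  ((d ∸ t) + k) + (t ∸ k) ∸ (t ∸ k)           ≡⟨ m+n∸n≡m ((d ∸ t) + k) (t ∸ k) ⟩
  (d ∸ t) + k                                 ∎
  where
  open ≡-Reasoning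
  split : ((d ∸ t) + k) + (t ∸ k) ≡ d
  split = trans (+-assoc (d ∸ t) k (t ∸ k)) (trans (cong ((d ∸ t) +_) (m+[n∸m]≡n k≤t)) (m∸n+n≡m t≤d))

module Tree (R : Raw) (V : Valid R) (u : Fin (Raw.n R)) where
  open RawOps R
  open Valid V

  NodeR : Set
  NodeR = Node n m

  ancestor : ℕ → NodeR → NodeR
  ancestor zero    x = x
  ancestor (suc i) x = ancestor i (par u x)

  ancestor-+ : ∀ a b x → ancestor a (ancestor b x) ≡ ancestor (b + a) x
  ancestor-+ a zero    x = refl
  ancestor-+ a (suc b) x = ancestor-+ a b (par u x)

  nonroot : ∀ {x} → 1 ≤ dep u x → x ≢ inj₁ u
  nonroot 1≤dep refl = <-irrefl (sym (rootDep u)) 1≤dep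

  private
    par-step : ∀ {x k} → inT u x ≡ true → dep u x ≡ suc k → inT u (par u x) ≡ true × dep u (par u x) ≡ k
    par-step {x} x∈T dep≡ =
      parIn u x x∈T x≢u , suc-injective (trans (sym (parDep u x x∈T x≢u)) dep≡)
      where x≢u = nonroot (subst (1 ≤_) (sym dep≡) (s≤s z≤n))

  ancestor-inT-dep : ∀ i x → inT u x ≡ true → i ≤ dep u x →
                     inT u (ancestor i x) ≡ true × dep u (ancestor i x) + i ≡ dep u x
  ancestor-inT-dep zero    x x∈T _   = x∈T , +-identityʳ _
  ancestor-inT-dep (suc i) x x∈T i<d with dep u x in dep≡
  ... | suc k with par-step x∈T dep≡
  ...   | p∈T , dep-p≡k with ancestor-inT-dep i (par u x) p∈T (subst (i ≤_) (sym dep-p≡k) (≤-pred i<d))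
  ...     | a∈T , dep-a = a∈T , trans (+-suc _ i) (cong suc (trans dep-a dep-p≡k))

  ∈-chain⁻ : ∀ j x {z} → z ∈ chain u j x → ∃[ i ] (i ≤ j × z ≡ ancestor i x)
  ∈-chain⁻ zero    x (here refl) = 0 , z≤n , refl
  ∈-chain⁻ (suc j) x (here refl) = 0 , z≤n , refl
  ∈-chain⁻ (suc j) x (there z∈) with ∈-chain⁻ j (par u x) z∈
  ... | i , i≤j , refl = suc i , s≤s i≤j , refl

  ∈-chain⁺ : ∀ j x {i} → i ≤ j → ancestor i x ∈ chain u j x
  ∈-chain⁺ zero    x {zero}  _         = here refl
  ∈-chain⁺ (suc j) x {zero}  _         = here refl
  ∈-chain⁺ (suc j) x {suc i} (s≤s i≤j) = there (∈-chain⁺ j (par u x) i≤j)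

  length-chain : ∀ j x → length (chain u j x) ≡ suc j
  length-chain zero    x = refl
  length-chain (suc j) x = cong suc (length-chain j (par u x))

  ∈-chain-dep : ∀ j x → inT u x ≡ true → j ≤ dep u x → ∀ {z} → z ∈ chain u j x →
                ∃[ i ] (i ≤ j × inT u z ≡ true × dep u z + i ≡ dep u x)
  ∈-chain-dep j x x∈T j≤d z∈ with ∈-chain⁻ j x z∈
  ... | i , i≤j , refl = i , i≤j , ancestor-inT-dep i x x∈T (≤-trans i≤j j≤d)

  -- Depths strictly decrease along a chain.
  chain-unique : ∀ j x → inT u x ≡ true → j ≤ dep u x → Unique (chain u j x)
  chain-unique zero    x _   _   = [] ∷ []
  chain-unique (suc j) x x∈T j<d with dep u x in dep≡
  ... | suc k with par-step x∈T dep≡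
  ...   | p∈T , dep-p≡k =
    All.tabulate (λ z∈ x≡z → below z∈ (trans (cong (dep u) (sym x≡z)) dep≡)) ∷ chain-unique j (par u x) p∈T j≤dep-p
    where
    j≤dep-p = subst (j ≤_) (sym dep-p≡k) (≤-pred j<d)
    below : ∀ {z} → z ∈ chain u j (par u x) → dep u z ≢ suc k
    below z∈ dep-z≡ with ∈-chain-dep j (par u x) p∈T j≤dep-p z∈
    ... | i , _ , _ , dep-z = <-irrefl refl (begin-strict
      k              <⟨ n<1+n k ⟩
      suc k          ≡⟨ sym dep-z≡ ⟩
      dep u _        ≤⟨ m≤m+n _ i ⟩
      dep u _ + i    ≡⟨ dep-z ⟩
      dep u (par u x) ≡⟨ dep-p≡k ⟩
      k              ∎)
      where open ≤-Reasoning

  -- The two endpoints of a tree edge have different depths.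
  pe-injective : ∀ {z z′} → inT u z ≡ true → z ≢ inj₁ u → inT u z′ ≡ true → z′ ≢ inj₁ u → pe u z ≡ pe u z′ → z ≡ z′
  pe-injective {z} {z′} z∈T z≢u z′∈T z′≢u pe≡ =
    ends (parEdge u z z∈T z≢u) (subst (λ f → joins f z′ (par u z′)) (sym pe≡) (parEdge u z′ z′∈T z′≢u))
    where
    not-crossed : z ≡ par u z′ → z′ ≡ par u z → ⊥
    not-crossed z≡ z′≡ = <-irrefl refl (begin-strict
      dep u z                  ≡⟨ cong (dep u) z≡ ⟩
      dep u (par u z′)         <⟨ n<1+n _ ⟩
      suc (dep u (par u z′))   ≡⟨ sym (parDep u z′ z′∈T z′≢u) ⟩
      dep u z′                 ≡⟨ cong (dep u) z′≡ ⟩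
      dep u (par u z)          <⟨ n<1+n _ ⟩
      suc (dep u (par u z))    ≡⟨ sym (parDep u z z∈T z≢u) ⟩
      dep u z                  ∎)
      where open ≤-Reasoning
    ends : joins (pe u z) z (par u z) → joins (pe u z) z′ (par u z′) → z ≡ z′
    ends (inj₁ (e₁ , e₂)) (inj₁ (e₁′ , e₂′)) = trans (sym e₁) e₁′
    ends (inj₁ (e₁ , e₂)) (inj₂ (e₁′ , e₂′)) = ⊥-elim (not-crossed (trans (sym e₁) e₁′) (trans (sym e₂′) e₂))
    ends (inj₂ (e₁ , e₂)) (inj₁ (e₁′ , e₂′)) = ⊥-elim (not-crossed (trans (sym e₂) e₂′) (trans (sym e₁′) e₁))
    ends (inj₂ (e₁ , e₂)) (inj₂ (e₁′ , e₂′)) = trans (sym e₂) e₂′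

  segOf : ℕ → NodeR → List (Fin M)
  segOf j y = map (pe u) (chain u j y)

  segOf-unique : ∀ j y → inT u y ≡ true → j < dep u y → Unique (segOf j y)
  segOf-unique j y y∈T j<d = map-unique (pe u) (chain-unique j y y∈T (<⇒≤ j<d)) (λ a∈ b∈ →
    let (i , i≤j , a∈T , dep-a) = ∈-chain-dep j y y∈T (<⇒≤ j<d) a∈
        (i′ , i′≤j , b∈T , dep-b) = ∈-chain-dep j y y∈T (<⇒≤ j<d) b∈
    in pe-injective a∈T (nonroot (above dep-a i≤j)) b∈T (nonroot (above dep-b i′≤j)))
    where
    above : ∀ {z i} → dep u z + i ≡ dep u y → i ≤ j → 1 ≤ dep u z
    above {z} {i} dep-z i≤j with dep u z
    ... | suc _ = s≤s z≤n
    ... | zero  = ⊥-elim (<-irrefl dep-z (≤-<-trans i≤j j<d))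

  length-segOf : ∀ j y → length (segOf j y) ≡ suc j
  length-segOf j y = trans (length-map (pe u) (chain u j y)) (length-chain j y)

  ∈-Nodes : ∀ (x : NodeR) → x ∈ Nodes
  ∈-Nodes (inj₁ a) = ∈-++⁺ˡ (∈-map⁺ inj₁ (∈-allFin a))
  ∈-Nodes (inj₂ b) = ∈-++⁺ʳ (map inj₁ (allFin n)) (∈-map⁺ inj₂ (∈-allFin b))

  depth-bound : ∀ x → inT u x ≡ true → suc (dep u x) ≤ n + m
  depth-bound x x∈T = subst₂ _≤_ (length-chain (dep u x) x) length-Nodes
    (NodeMult.length-≤-unique-⊆ (chain u (dep u x) x) Nodes (chain-unique (dep u x) x x∈T ≤-refl) (λ {z} _ → ∈-Nodes z))
    where
    module NodeMult = Multiplicity (_≟N_ {n} {m})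
    length-Nodes : length Nodes ≡ n + m
    length-Nodes = trans (length-++ (map inj₁ (allFin n)))
      (cong₂ _+_ (trans (length-map inj₁ (allFin n)) (length-tabulate {n = n} (λ i → i)))
                 (trans (length-map inj₂ (allFin m)) (length-tabulate {n = m} (λ i → i))))

12t≤7d⇒t≤d : ∀ {t d} → 12 * t ≤ 7 * d → t ≤ d
12t≤7d⇒t≤d {t} {d} 12t≤7d = *-cancelˡ-≤ 12 (≤-trans 12t≤7d (*-monoˡ-≤ d (≤ᵇ⇒≤ 7 12 tt)))

12t≤7d⇒t≤2[d∸t] : ∀ {t d} → 12 * t ≤ 7 * d → t ≤ 2 * (d ∸ t)
12t≤7d⇒t≤2[d∸t] {t} {d} 12t≤7d = *-cancelˡ-≤ 5 (begin
  5 * t          ≤⟨ +-cancelˡ-≤ (7 * t) _ _ (begin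
                      7 * t + 5 * t      ≡⟨ 7x+5x≡12x t ⟩
                      12 * t             ≤⟨ 12t≤7d ⟩
                      7 * d              ≡⟨ cong (7 *_) (sym (m+[n∸m]≡n t≤d)) ⟩
                      7 * (t + i)        ≡⟨ *-distribˡ-+ 7 t i ⟩
                      7 * t + 7 * i      ∎) ⟩
  7 * i          ≤⟨ *-monoˡ-≤ i (≤ᵇ⇒≤ 7 10 tt) ⟩
  10 * i         ≡⟨ 10x≡5[2x] i ⟩
  5 * (2 * i)    ∎)
  where
  open ≤-Reasoning
  t≤d = 12t≤7d⇒t≤d {t} {d} 12t≤7d
  i = d ∸ t
  7x+5x≡12x : ∀ x → 7 * x + 5 * x ≡ 12 * x
  7x+5x≡12x = solve-∀
  10x≡5[2x] : ∀ x → 10 * x ≡ 5 * (2 * x)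
  10x≡5[2x] = solve-∀

5d<12t⇒1≤t : ∀ {d t} → 5 * d < 12 * t → 1 ≤ t
5d<12t⇒1≤t {d} {zero}  5d<0 = ⊥-elim (n≮0 (subst (5 * d <_) (*-zeroʳ 12) 5d<0))
5d<12t⇒1≤t {d} {suc t} _    = s≤s z≤n

-- The top t = r - ⌊r/8⌋ of the segment above depth r satisfies 12t ≥ 21r/2 > 5d.
far-window : ∀ {r d} → d < 2 * r → 5 * d < 12 * (r ∸ r / 8)
far-window {r} {d} d<2r = *-cancelˡ-≤ 2 (+-cancelʳ-≤ (24 * k) _ _ (begin
  2 * suc (5 * d) + 24 * k          ≡⟨ expand d k ⟩
  2 + 10 * d + 3 * (8 * k)          ≤⟨ +-monoʳ-≤ (2 + 10 * d) (*-monoʳ-≤ 3 8k≤r) ⟩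
  2 + 10 * d + 3 * r                ≤⟨ +-monoˡ-≤ (3 * r) (+-monoˡ-≤ (10 * d) (≤ᵇ⇒≤ 2 10 tt)) ⟩
  10 + 10 * d + 3 * r               ≡⟨ cong (_+ 3 * r) (sym (*-suc 10 d)) ⟩
  10 * suc d + 3 * r                ≤⟨ +-monoˡ-≤ (3 * r) (*-monoʳ-≤ 10 d<2r) ⟩
  10 * (2 * r) + 3 * r              ≤⟨ +-monoʳ-≤ (10 * (2 * r)) (*-monoˡ-≤ r (≤ᵇ⇒≤ 3 4 tt)) ⟩
  10 * (2 * r) + 4 * r              ≡⟨ cong (λ x → 10 * (2 * x) + 4 * x) (sym t+k≡r) ⟩
  10 * (2 * (t + k)) + 4 * (t + k)  ≡⟨ collect t k ⟩
  2 * (12 * t) + 24 * k             ∎))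
  where
  open ≤-Reasoning
  k = r / 8
  t = r ∸ k
  t+k≡r : t + k ≡ r
  t+k≡r = m∸n+n≡m (m/n≤m r 8)
  8k≤r : 8 * k ≤ r
  8k≤r = subst (_≤ r) (*-comm k 8) (m/n*n≤m r 8)
  expand : ∀ d k → 2 * suc (5 * d) + 24 * k ≡ 2 + 10 * d + 3 * (8 * k)
  expand = solve-∀
  collect : ∀ t k → 10 * (2 * (t + k)) + 4 * (t + k) ≡ 2 * (12 * t) + 24 * k
  collect = solve-∀

-- For r = r′ + 1 and q = ⌊r′/7⌋, the segment above depth r + q has its top edge at depth r.
near-quotient : ∀ r′ → (suc r′ + r′ / 7) / 8 ≡ r′ / 7
near-quotient r′ = begin
  (suc r′ + q) / 8             ≡⟨ cong (λ x → (suc x + q) / 8) (m≡m%n+[m/n]*n r′ 7) ⟩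
  (suc (ρ + q * 7) + q) / 8    ≡⟨ cong (_/ 8) (regroup ρ q) ⟩
  (suc ρ + q * 8) / 8          ≡⟨ +-distrib-/-∣ʳ (suc ρ) (n∣m*n q) ⟩
  suc ρ / 8 + q * 8 / 8        ≡⟨ cong₂ _+_ (m<n⇒m/n≡0 (s≤s (m%n<n r′ 7))) (m*n/n≡m q 8) ⟩
  q                            ∎
  where
  open ≡-Reasoning
  q = r′ / 7
  ρ = r′ % 7
  regroup : ∀ x y → suc (x + y * 7) + y ≡ suc x + y * 8
  regroup = solve-∀

near-window : ∀ {r′ d} → 2 * suc r′ ≤ d → 12 * (suc r′ + r′ / 7) ≤ 7 * d
near-window {r′} {d} 2r≤d = begin
  12 * (r + q)          ≡⟨ *-distribˡ-+ 12 r q ⟩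
  12 * r + 12 * q       ≤⟨ +-monoʳ-≤ (12 * r) (*-monoˡ-≤ q (≤ᵇ⇒≤ 12 14 tt)) ⟩
  12 * r + 14 * q       ≡⟨ cong (12 * r +_) (14x≡2[7x] q) ⟩
  12 * r + 2 * (7 * q)  ≤⟨ +-monoʳ-≤ (12 * r) (*-monoʳ-≤ 2 7q≤r) ⟩
  12 * r + 2 * r        ≡⟨ 12x+2x≡7[2x] r ⟩
  7 * (2 * r)           ≤⟨ *-monoʳ-≤ 7 2r≤d ⟩
  7 * d                 ∎
  where
  open ≤-Reasoning
  r = suc r′
  q = r′ / 7
  7q≤r : 7 * q ≤ r
  7q≤r = ≤-trans (subst (_≤ r′) (*-comm q 7) (m/n*n≤m r′ 7)) (n≤1+n r′)
  14x≡2[7x] : ∀ x → 14 * x ≡ 2 * (7 * x)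
  14x≡2[7x] = solve-∀
  12x+2x≡7[2x] : ∀ x → 12 * x + 2 * x ≡ 7 * (2 * x)
  12x+2x≡7[2x] = solve-∀

-- Charging hub edges to skeleton nodes

module Charging (R : Raw) (V : Valid R) (u : Fin (Raw.n R)) where
  open RawOps R
  open Valid V
  open Tree R V u

  argminBy-nothing : ∀ ρ es → argminBy ρ es ≡ nothing → es ≡ []
  argminBy-nothing ρ []       _  = refl
  argminBy-nothing ρ (e ∷ es) eq with argminBy ρ es
  ... | just f with toℕ (ρ e) <ᵇ toℕ (ρ f)
  argminBy-nothing ρ (e ∷ es) () | just f | true
  argminBy-nothing ρ (e ∷ es) () | just f | false

  argminBy-spec : ∀ ρ es {e} → argminBy ρ es ≡ just e → e ∈ es × (∀ {c} → c ∈ es → toℕ (ρ e) ≤ toℕ (ρ c))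
  argminBy-spec ρ (a ∷ es) eq with argminBy ρ es in eq′
  argminBy-spec ρ (a ∷ es) refl | nothing rewrite argminBy-nothing ρ es eq′ = here refl , λ { (here refl) → ≤-refl }
  argminBy-spec ρ (a ∷ es) eq | just f with toℕ (ρ a) <ᵇ toℕ (ρ f) in a<f | argminBy-spec ρ es eq′
  argminBy-spec ρ (a ∷ es) refl | just f | true | _ , f-min =
    here refl , λ { (here refl) → ≤-refl ; (there c∈) → ≤-trans (<⇒≤ (<ᵇ⇒< _ _ (Equivalence.from T-≡ a<f))) (f-min c∈) }
  argminBy-spec ρ (a ∷ es) refl | just f | false | f∈ , f-min =
    there f∈ , λ { (here refl) → ≮⇒≥ (λ f<a → subst T a<f (<⇒<ᵇ f<a)) ; (there c∈) → f-min c∈ }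

  ==-refl : ∀ (x : NodeR) → T (x == x)
  ==-refl x = fromWitness refl

  reach-≥ : ∀ {y z} → inT u z ≡ true → y ∈ pathNodes u z → dep u z ∸ dep u y ≤ reach u y
  reach-≥ {y} {z} z∈T y∈ = maxℕ-upper (∈-map⁺ (λ x → dep u x ∸ dep u y)
    (∈-filter⁺ (T? ∘ (λ x → inT u x ∧ isAnc u y x)) (∈-Nodes z)
      (Equivalence.from T-∧ (Equivalence.from T-≡ z∈T , any⁺ (_== y) (Any.map (λ { refl → ==-refl y }) y∈)))))

  inSkel⁺ : ∀ {y} → inT u y ≡ true → dep u y ≤ 2 * reach u y → T (inSkel u y)
  inSkel⁺ y∈T d≤2r rewrite y∈T = ≤⇒≤ᵇ d≤2r

  inSkel⁻ : ∀ {y} → T (inSkel u y) → inT u y ≡ true × dep u y ≤ 2 * reach u y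
  inSkel⁻ {y} sk with Equivalence.to (T-∧ {inT u y}) sk
  ... | y∈T , d≤2r = Equivalence.to T-≡ y∈T , ≤ᵇ⇒≤ _ _ d≤2r

  inSkel∖root : NodeR → Bool
  inSkel∖root y = inSkel u y ∧ not (y == inj₁ u)

  inSkel∖root⁺ : ∀ {y} → T (inSkel u y) → y ≢ inj₁ u → T (inSkel∖root y)
  inSkel∖root⁺ sk y≢u = Equivalence.from T-∧ (sk , fromWitnessFalse y≢u)

  inSkel∖root⁻ : ∀ {y} → T (inSkel∖root y) → T (inSkel u y) × 1 ≤ dep u y
  inSkel∖root⁻ {y} t with Equivalence.to (T-∧ {inSkel u y}) t
  ... | sk , y≢u with inSkel⁻ sk
  ...   | y∈T , _ rewrite parDep u y y∈T (toWitnessFalse y≢u) = sk , s≤s z≤n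

  -- A skeleton node y is charged with the bottom or the top edge of the segment formed by the
  -- ⌊d_u(y)/8⌋ + 1 tree edges above y, when that edge has the least ρ-value on the segment.
  top : NodeR → NodeR
  top y = ancestor (dep u y / 8) y

  segment : NodeR → List (Fin M)
  segment y = segOf (dep u y / 8) y

  endEdge : NodeR ⊎ NodeR → Fin M
  endEdge (inj₁ y) = pe u y
  endEdge (inj₂ y) = pe u (top y)

  charged : (Fin M → Fin M) → NodeR ⊎ NodeR → Bool
  charged ρ c = inSkel∖root (reduce c) ∧ isMinᵇ ρ (endEdge c) (segment (reduce c))

  charges : List (NodeR ⊎ NodeR)
  charges = map inj₁ Nodes ++ map inj₂ Nodes

  ∈-charges : ∀ c → c ∈ charges
  ∈-charges (inj₁ y) = ∈-++⁺ˡ (∈-map⁺ inj₁ (∈-Nodes y))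
  ∈-charges (inj₂ y) = ∈-++⁺ʳ (map inj₁ Nodes) (∈-map⁺ inj₂ (∈-Nodes y))

  module OnPath (v : Fin n) where

    d : ℕ
    d = dep u (inj₁ v)

    nodeAt : ℕ → NodeR
    nodeAt t = ancestor (d ∸ t) (inj₁ v)

    nodeAt-inT-dep : ∀ {t} → t ≤ d → inT u (nodeAt t) ≡ true × dep u (nodeAt t) ≡ t
    nodeAt-inT-dep {t} t≤d with ancestor-inT-dep (d ∸ t) (inj₁ v) (termIn u v) (m∸n≤m d t)
    ... | a∈T , dep-a = a∈T , +-cancelʳ-≡ (d ∸ t) _ t (trans dep-a (sym (m+[n∸m]≡n t≤d)))

    nodeAt-dep : ∀ {t} → t ≤ d → dep u (nodeAt t) ≡ t
    nodeAt-dep t≤d = proj₂ (nodeAt-inT-dep t≤d)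

    nodeAt-∈-path : ∀ {t} → t ≤ d → nodeAt t ∈ pathNodes u (inj₁ v)
    nodeAt-∈-path {t} _ = ∈-chain⁺ d (inj₁ v) (m∸n≤m d t)

    ∈-path⇒nodeAt : ∀ {x} → x ∈ pathNodes u (inj₁ v) → ∃[ t ] (t ≤ d × x ≡ nodeAt t)
    ∈-path⇒nodeAt x∈ with ∈-chain⁻ d (inj₁ v) x∈
    ... | i , i≤d , refl = d ∸ i , m∸n≤m d i , cong (λ k → ancestor k (inj₁ v)) (sym (m∸[m∸n]≡n i≤d))

    ancestor-nodeAt : ∀ {k t} → k ≤ t → t ≤ d → ancestor k (nodeAt t) ≡ nodeAt (t ∸ k)
    ancestor-nodeAt {k} {t} k≤t t≤d =
      trans (ancestor-+ k (d ∸ t) (inj₁ v)) (cong (λ i → ancestor i (inj₁ v)) (sym (∸-∸≡∸+ k≤t t≤d)))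

    -- v lies d - t levels below nodeAt t, so that node is in the skeleton once t ≤ 2(d - t).
    nodeAt-inSkel∖root : ∀ {t} → 1 ≤ t → 12 * t ≤ 7 * d → T (inSkel∖root (nodeAt t))
    nodeAt-inSkel∖root {t} 1≤t 12t≤7d = inSkel∖root⁺ (inSkel⁺ t∈T (begin
      dep u (nodeAt t)                  ≡⟨ nodeAt-dep t≤d ⟩
      t                                 ≤⟨ 12t≤7d⇒t≤2[d∸t] 12t≤7d ⟩
      2 * (d ∸ t)                       ≡⟨ cong (λ x → 2 * (d ∸ x)) (sym (nodeAt-dep t≤d)) ⟩
      2 * (d ∸ dep u (nodeAt t))        ≤⟨ *-monoʳ-≤ 2 (reach-≥ (termIn u v) (nodeAt-∈-path t≤d)) ⟩
      2 * reach u (nodeAt t)            ∎))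
      (nonroot (subst (1 ≤_) (sym (nodeAt-dep t≤d)) 1≤t))
      where
      open ≤-Reasoning
      t≤d = 12t≤7d⇒t≤d 12t≤7d
      t∈T = proj₁ (nodeAt-inT-dep t≤d)

    central⁺ : ∀ {t} → t ≤ d → 5 * d < 12 * t → 12 * t ≤ 7 * d → pe u (nodeAt t) ∈ central u v
    central⁺ {t} t≤d 5d<12t 12t≤7d = ∈-map⁺ (pe u) (∈-filter⁺ (T? ∘ window) (nodeAt-∈-path t≤d)
      (subst (T ∘ window′) (sym (nodeAt-dep t≤d)) (Equivalence.from T-∧ (<⇒<ᵇ 5d<12t , ≤⇒≤ᵇ 12t≤7d))))
      where
      window′ : ℕ → Bool
      window′ s = (5 * d <ᵇ 12 * s) ∧ (12 * s ℕ.≤ᵇ 7 * d)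
      window : NodeR → Bool
      window = window′ ∘ dep u

    central⁻ : ∀ {e} → e ∈ central u v → ∃[ t ] (t ≤ d × 5 * d < 12 * t × 12 * t ≤ 7 * d × e ≡ pe u (nodeAt t))
    central⁻ e∈ with ∈-map⁻ (pe u) e∈
    ... | x , x∈ , refl with ∈-filter⁻ (T? ∘ (λ x → (5 * d <ᵇ 12 * dep u x) ∧ (12 * dep u x ℕ.≤ᵇ 7 * d))) x∈
    ...   | x∈path , in-window with ∈-path⇒nodeAt x∈path
    ...     | t , t≤d , refl with Equivalence.to (T-∧ {5 * d <ᵇ 12 * dep u (nodeAt t)}) in-window
    ...       | lower , upper rewrite nodeAt-dep t≤d = t , t≤d , <ᵇ⇒< _ _ lower , ≤ᵇ⇒≤ _ _ upper , refl

    segment-⊆-central : ∀ {s j} → s ≤ d → s / 8 ≡ j → 5 * d < 12 * (s ∸ j) → 12 * s ≤ 7 * d →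
                        ∀ {c} → c ∈ segment (nodeAt s) → c ∈ central u v
    segment-⊆-central {s} {j} s≤d s/8≡j lower upper c∈
      with ∈-map⁻ (pe u) (subst (λ k → _ ∈ segOf (k / 8) (nodeAt s)) (nodeAt-dep s≤d) c∈)
    ... | z , z∈ , refl with ∈-chain⁻ (s / 8) (nodeAt s) z∈
    ...   | k , k≤s/8 , refl rewrite ancestor-nodeAt (≤-trans k≤s/8 (m/n≤m s 8)) s≤d =
      central⁺ (≤-trans (m∸n≤m s k) s≤d)
        (<-≤-trans lower (*-monoʳ-≤ 12 (∸-monoʳ-≤ s (subst (k ≤_) s/8≡j k≤s/8))))
        (≤-trans (*-monoʳ-≤ 12 (m∸n≤m s k)) upper)

    module _ (ρ : Fin M → Fin M) {a} (a-min : ∀ {c} → c ∈ central u v → toℕ (ρ a) ≤ toℕ (ρ c)) where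

      isMin-segment : ∀ {s j} → s ≤ d → s / 8 ≡ j → 5 * d < 12 * (s ∸ j) → 12 * s ≤ 7 * d →
                      T (isMinᵇ ρ a (segment (nodeAt s)))
      isMin-segment s≤d s/8≡j lower upper = isMin⁺ ρ (a-min ∘ segment-⊆-central s≤d s/8≡j lower upper)

      charge-far : ∀ {r} → r ≤ d → 5 * d < 12 * r → 12 * r ≤ 7 * d → d < 2 * r → a ≡ pe u (nodeAt r) →
                   T (charged ρ (inj₁ (nodeAt r)))
      charge-far {r} r≤d lower upper d<2r refl = Equivalence.from T-∧
        (nodeAt-inSkel∖root {r} (5d<12t⇒1≤t {d} lower) upper , isMin-segment {r} {r / 8} r≤d refl (far-window {r} {d} d<2r) upper)

      -- Here r ≤ d/2, and the segment above s = r + ⌊(r-1)/7⌋ ends exactly at depth r.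
      charge-near : ∀ {r′} → suc r′ ≤ d → 5 * d < 12 * suc r′ → 2 * suc r′ ≤ d → a ≡ pe u (nodeAt (suc r′)) →
                    let s = suc r′ + r′ / 7 in T (charged ρ (inj₂ (nodeAt s))) × endEdge (inj₂ (nodeAt s)) ≡ a
      charge-near {r′} r≤d lower 2r≤d refl =
        Equivalence.from T-∧ (nodeAt-inSkel∖root (≤-trans (s≤s z≤n) (m≤m+n (suc r′) q)) upper ,
                              subst (λ x → T (isMinᵇ ρ (pe u x) (segment (nodeAt s)))) (sym top≡)
                                (isMin-segment s≤d (near-quotient r′) (subst (λ x → 5 * d < 12 * x) (sym s∸q≡r) lower) upper)) ,
        cong (pe u) top≡
        where
        q = r′ / 7
        s = suc r′ + q
        upper = near-window 2r≤d
        s≤d = 12t≤7d⇒t≤d upper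
        s∸q≡r : s ∸ q ≡ suc r′
        s∸q≡r = m+n∸n≡m (suc r′) q
        top≡ : top (nodeAt s) ≡ nodeAt (suc r′)
        top≡ = begin
          ancestor (dep u (nodeAt s) / 8) (nodeAt s)  ≡⟨ cong (λ k → ancestor (k / 8) (nodeAt s)) (nodeAt-dep s≤d) ⟩
          ancestor (s / 8) (nodeAt s)                 ≡⟨ cong (λ k → ancestor k (nodeAt s)) (near-quotient r′) ⟩
          ancestor q (nodeAt s)                       ≡⟨ ancestor-nodeAt (m≤n+m q (suc r′)) s≤d ⟩
          nodeAt (s ∸ q)                              ≡⟨ cong nodeAt s∸q≡r ⟩
          nodeAt (suc r′)                             ∎
          where open ≡-Reasoning

  hub-charged : ∀ ρ v {e} → hub ρ u v ≡ just e → ∃[ c ] (T (charged ρ c) × endEdge c ≡ e)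
  hub-charged ρ v hub≡ with argminBy-spec ρ (central u v) hub≡
  ... | e∈ , e-min with OnPath.central⁻ v e∈
  ...   | zero   , _   , lower , _     , _ = ⊥-elim (n≮0 (subst (5 * OnPath.d v <_) (*-zeroʳ 12) lower))
  ...   | suc r′ , r≤d , lower , upper , e≡ with OnPath.d v <? 2 * suc r′
  ...     | yes far  = inj₁ _ , OnPath.charge-far v ρ e-min r≤d lower upper far e≡ , sym e≡
  ...     | no  near = inj₂ _ , OnPath.charge-near v ρ e-min r≤d lower (≮⇒≥ near) e≡

-- Expected hub set sizes

m≤8*[1+m/8] : ∀ m → m ≤ 8 * suc (m / 8)
m≤8*[1+m/8] m = <⇒≤ (begin-strict
  m                        ≡⟨ m≡m%n+[m/n]*n m 8 ⟩
  m % 8 + (m / 8) * 8      <⟨ +-monoˡ-< ((m / 8) * 8) (m%n<n m 8) ⟩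
  8 + (m / 8) * 8          ≡⟨ cong (8 +_) (*-comm (m / 8) 8) ⟩
  8 + 8 * (m / 8)          ≡⟨ sym (*-suc 8 (m / 8)) ⟩
  8 * suc (m / 8)          ∎)
  where open ≤-Reasoning

/8< : ∀ D → 1 ≤ D → D / 8 < D
/8< (suc a) _ = m/n<m (suc a) 8 (≤ᵇ⇒≤ 2 8 tt)

inv-1+/8 : ∀ D → 1 ≤ D → inv (suc (D / 8)) ≤ℚ ℕ→ℚ 8 *ℚ inv D
inv-1+/8 (suc a) _ = inv-≤-* a (suc a / 8) 8 (m≤8*[1+m/8] (suc a))

module Expectation (R : Raw) (V : Valid R) (u : Fin (Raw.n R)) where
  open RawOps R
  open Valid V
  open Tree R V u
  open Charging R V u
  open Rankings R

  -- The edge test of hubSetSize is local to its definition; unification recovers it.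
  hubSetSize-test : ∀ ρ → Σ[ Q ∈ (Fin M → Fin n → Bool) ] hubSetSize ρ u ≡ countᵇ (λ e → any (Q e) (allFin n)) (allFin M)
  hubSetSize-test ρ = _ , refl

  hubSetSize-test-sound : ∀ ρ {e v} → T (proj₁ (hubSetSize-test ρ) e v) → hub ρ u v ≡ just e
  hubSetSize-test-sound ρ {e} {v} t with hub ρ u v
  ... | nothing = ⊥-elim (proj₂ (Equivalence.to (T-∧ {not ⌊ v ≟ᶠ u ⌋}) t))
  ... | just f with e ≟ᶠ f
  ...   | yes refl = refl
  ...   | no _     = ⊥-elim (proj₂ (Equivalence.to (T-∧ {not ⌊ v ≟ᶠ u ⌋}) t))

  hubSetSize-≤ : ∀ ρ → hubSetSize ρ u ≤ ∑ charges (𝟙 ∘ charged ρ)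
  hubSetSize-≤ ρ = begin
    hubSetSize ρ u               ≡⟨ proj₂ (hubSetSize-test ρ) ⟩
    countᵇ hit (allFin M)        ≡⟨ length-filterᵇ hit (allFin M) ⟩
    ∑ (allFin M) (𝟙 ∘ hit)       ≤⟨ FinMult.count-≤-cover (allFin M) charges hit (charged ρ) endEdge (allFin⁺ M) covered ⟩
    ∑ charges (𝟙 ∘ charged ρ)    ∎
    where
    open ≤-Reasoning
    Q = proj₁ (hubSetSize-test ρ)
    hit : Fin M → Bool
    hit e = any (Q e) (allFin n)
    covered : ∀ {e} → e ∈ allFin M → T (hit e) → ∃[ c ] (c ∈ charges × T (charged ρ c) × endEdge c ≡ e)
    covered {e} _ t with Any.satisfied (any⁻ (Q e) (allFin n) t)
    ... | v , test with hub-charged ρ v (hubSetSize-test-sound ρ test)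
    ...   | c , c-charged , end≡ = c , ∈-charges c , c-charged , end≡

  weight : NodeR → ℚ
  weight y = if inSkel∖root y then inv (dep u y) else 0ℚ

  endEdge-∈-segment : ∀ c → endEdge c ∈ segment (reduce c)
  endEdge-∈-segment (inj₁ y) = ∈-map⁺ (pe u) (∈-chain⁺ (dep u y / 8) y {0} z≤n)
  endEdge-∈-segment (inj₂ y) = ∈-map⁺ (pe u) (∈-chain⁺ (dep u y / 8) y ≤-refl)

  -- A fixed edge of the segment above y is its ρ-minimum with probability 1/(⌊d_u(y)/8⌋ + 1) ≤ 8/d_u(y).
  count-charged : ∀ c → ℕ→ℚ (∑ rankings (λ ρ → 𝟙 (charged (lookup ρ) c))) ≤ℚ
                        ℕ→ℚ (length rankings) *ℚ (ℕ→ℚ 8 *ℚ weight (reduce c))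
  count-charged c = by-skeleton (inSkel∖root y) refl
    where
    y = reduce c
    j = dep u y / 8
    count≡ : ∀ {b} → inSkel∖root y ≡ b →
             ∑ rankings (λ ρ → 𝟙 (charged (lookup ρ) c)) ≡
             ∑ rankings (λ ρ → 𝟙 (b ∧ isMinᵇ (lookup ρ) (endEdge c) (segment y)))
    count≡ sk = ∑-≗ rankings (λ ρ → cong (λ b → 𝟙 (b ∧ isMinᵇ (lookup ρ) (endEdge c) (segment y))) sk)
    by-skeleton : ∀ b → inSkel∖root y ≡ b → ℕ→ℚ (∑ rankings (λ ρ → 𝟙 (charged (lookup ρ) c))) ≤ℚ
                  ℕ→ℚ (length rankings) *ℚ (ℕ→ℚ 8 *ℚ (if b then inv (dep u y) else 0ℚ))
    by-skeleton false sk = begin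
      ℕ→ℚ (∑ rankings (λ ρ → 𝟙 (charged (lookup ρ) c)))   ≡⟨ cong ℕ→ℚ (trans (count≡ sk) (∑-zero rankings)) ⟩
      0ℚ                                                  ≤⟨ *-nonNeg (ℕ→ℚ-nonNeg (length rankings)) (*-nonNeg (ℕ→ℚ-nonNeg 8) ℚP.≤-refl) ⟩
      ℕ→ℚ (length rankings) *ℚ (ℕ→ℚ 8 *ℚ 0ℚ)              ∎
      where open ℚP.≤-Reasoning
    by-skeleton true sk = begin
      ℕ→ℚ (∑ rankings (λ ρ → 𝟙 (charged (lookup ρ) c)))   ≡⟨ cong ℕ→ℚ (count≡ sk) ⟩
      ℕ→ℚ (minCount (endEdge c) (segment y))              ≤⟨ *≤⇒≤*inv j _ (length rankings) count-bound ⟩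
      ℕ→ℚ (length rankings) *ℚ inv (suc j)                ≤⟨ *-monoˡ-≤-nonNeg (ℕ→ℚ-nonNeg (length rankings)) (inv-1+/8 (dep u y) 1≤dep) ⟩
      ℕ→ℚ (length rankings) *ℚ (ℕ→ℚ 8 *ℚ inv (dep u y))   ∎
      where
      open ℚP.≤-Reasoning
      sk∧1≤dep = inSkel∖root⁻ {y} (Equivalence.from T-≡ sk)
      1≤dep = proj₂ sk∧1≤dep
      count-bound : suc j * minCount (endEdge c) (segment y) ≤ length rankings
      count-bound = subst (λ L → L * minCount (endEdge c) (segment y) ≤ length rankings) (length-segOf j y)
        (length*minCount≤length-rankings (segOf-unique j y (proj₁ (inSkel⁻ (proj₁ sk∧1≤dep))) (/8< (dep u y) 1≤dep))
                                         (endEdge-∈-segment c))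

  expected-hubSetSize : ∑ℚ rankings (λ ρ → ℕ→ℚ (hubSetSize (lookup ρ) u)) ≤ℚ
                        ℕ→ℚ (length rankings) *ℚ (ℕ→ℚ 16 *ℚ isk u)
  expected-hubSetSize = begin
    ∑ℚ rankings (λ ρ → ℕ→ℚ (hubSetSize (lookup ρ) u))         ≡⟨ ∑ℚ-ℕ→ℚ rankings _ ⟩
    ℕ→ℚ (∑ rankings (λ ρ → hubSetSize (lookup ρ) u))          ≤⟨ ℕ→ℚ-mono-≤ (∑-mono-≤ rankings (λ {ρ} _ → hubSetSize-≤ (lookup ρ))) ⟩
    ℕ→ℚ (∑ rankings (λ ρ → ∑ charges (𝟙 ∘ charged (lookup ρ)))) ≡⟨ cong ℕ→ℚ (∑-comm rankings charges _) ⟩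
    ℕ→ℚ (∑ charges count)                                ≡⟨ sym (∑ℚ-ℕ→ℚ charges count) ⟩
    ∑ℚ charges (ℕ→ℚ ∘ count)                               ≤⟨ ∑ℚ-mono-≤ charges (λ {c} _ → count-charged c) ⟩
    ∑ℚ charges (bound ∘ reduce)                               ≡⟨ ℚ∑.∑-++ (map inj₁ Nodes) (map inj₂ Nodes) (bound ∘ reduce) ⟩
    ∑ℚ (map inj₁ Nodes) (bound ∘ reduce) +ℚ ∑ℚ (map inj₂ Nodes) (bound ∘ reduce)
                                                              ≡⟨ cong₂ _+ℚ_ (ℚ∑.∑-map Nodes inj₁ _) (ℚ∑.∑-map Nodes inj₂ _) ⟩
    ∑ℚ Nodes bound +ℚ ∑ℚ Nodes bound                          ≡⟨ cong₂ _+ℚ_ ∑bound ∑bound ⟩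
    N *ℚ (ℕ→ℚ 8 *ℚ isk u) +ℚ N *ℚ (ℕ→ℚ 8 *ℚ isk u)            ≡⟨ double N (ℕ→ℚ 8) (isk u) ⟩
    N *ℚ ((ℕ→ℚ 8 +ℚ ℕ→ℚ 8) *ℚ isk u)                          ≡⟨ cong (λ x → N *ℚ (x *ℚ isk u)) (sym (ℕ→ℚ-+ 8 8)) ⟩
    N *ℚ (ℕ→ℚ 16 *ℚ isk u)                                    ∎
    where
    open ℚP.≤-Reasoning
    open +-*-Solver
    N = ℕ→ℚ (length rankings)
    count : NodeR ⊎ NodeR → ℕ
    count c = ∑ rankings (λ ρ → 𝟙 (charged (lookup ρ) c))
    bound : NodeR → ℚ
    bound y = N *ℚ (ℕ→ℚ 8 *ℚ weight y)
    ∑bound : ∑ℚ Nodes bound ≡ N *ℚ (ℕ→ℚ 8 *ℚ isk u)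
    ∑bound = trans (ℚ∑.∑-*ˡ Nodes N _) (cong (N *ℚ_) (trans (ℚ∑.∑-*ˡ Nodes (ℕ→ℚ 8) weight)
               (cong (ℕ→ℚ 8 *ℚ_) (sym (ℚ∑.∑-filterᵇ inSkel∖root Nodes (inv ∘ dep u))))))
    double : ∀ a b x → a *ℚ (b *ℚ x) +ℚ a *ℚ (b *ℚ x) ≡ a *ℚ ((b +ℚ b) *ℚ x)
    double = solve 3 (λ a b x → a :* (b :* x) :+ a :* (b :* x) := a :* ((b :+ b) :* x)) refl

module _ (R : Raw) (V : Valid R) where
  open RawOps R
  open Rankings R

  expected-sumS : ∑ℚ rankings (λ ρ → ℕ→ℚ (sumS (lookup ρ))) ≤ℚ ℕ→ℚ (length rankings) *ℚ (ℕ→ℚ 16 *ℚ sumIsk)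
  expected-sumS = begin
    ∑ℚ rankings (λ ρ → ℕ→ℚ (sumS (lookup ρ)))
      ≡⟨ ℚ∑.∑-≗ rankings (λ ρ → sym (∑ℚ-ℕ→ℚ (allFin n) (hubSetSize (lookup ρ)))) ⟩
    ∑ℚ rankings (λ ρ → ∑ℚ (allFin n) (λ u → ℕ→ℚ (hubSetSize (lookup ρ) u)))
      ≡⟨ ℚ∑.∑-comm rankings (allFin n) _ ⟩
    ∑ℚ (allFin n) (λ u → ∑ℚ rankings (λ ρ → ℕ→ℚ (hubSetSize (lookup ρ) u)))
      ≤⟨ ∑ℚ-mono-≤ (allFin n) (λ {u} _ → Expectation.expected-hubSetSize R V u) ⟩
    ∑ℚ (allFin n) (λ u → N *ℚ (ℕ→ℚ 16 *ℚ isk u))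
      ≡⟨ ℚ∑.∑-*ˡ (allFin n) N _ ⟩
    N *ℚ ∑ℚ (allFin n) (λ u → ℕ→ℚ 16 *ℚ isk u)
      ≡⟨ cong (N *ℚ_) (ℚ∑.∑-*ˡ (allFin n) (ℕ→ℚ 16) isk) ⟩
    N *ℚ (ℕ→ℚ 16 *ℚ sumIsk) ∎
    where
    open ℚP.≤-Reasoning
    N = ℕ→ℚ (length rankings)

  sumIsk-nonNeg : 0ℚ ≤ℚ sumIsk
  sumIsk-nonNeg = ∑ℚ-nonNeg (allFin n) (λ u →
    ∑ℚ-nonNeg (filterᵇ (Charging.inSkel∖root R V u) Nodes) (λ v → inv-nonNeg (dep u v)))

  sumS-≤-32-sumIsk-with-probability-½ :
    length rankings ≤ 2 * length (filterᵇ (λ ρ → ℕ→ℚ (sumS (lookup ρ)) ≤ᵇ (ℕ→ℚ 32 *ℚ sumIsk)) rankings)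
  sumS-≤-32-sumIsk-with-probability-½ =
    subst (λ t → length rankings ≤ 2 * length (filterᵇ (λ ρ → ℕ→ℚ (sumS (lookup ρ)) ≤ᵇ t) rankings))
          (trans (sym (ℚP.*-assoc (ℕ→ℚ 2) (ℕ→ℚ 16) sumIsk)) (cong (_*ℚ sumIsk) (sym (ℕ→ℚ-* 2 16))))
          (markov rankings (λ ρ → ℕ→ℚ (sumS (lookup ρ))) (ℕ→ℚ 16 *ℚ sumIsk)
                  (λ ρ → ℕ→ℚ-nonNeg (sumS (lookup ρ))) (*-nonNeg (ℕ→ℚ-nonNeg 16) sumIsk-nonNeg) expected-sumS)

-- The integrated skeleton dimension

module SkeletonDepths (R : Raw) (V : Valid R) (u : Fin (Raw.n R)) where
  open RawOps R
  open Valid V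
  open Tree R V u
  open Charging R V u

  lcaDepth-root : ∀ z → lcaDepth u (inj₁ u) z ≡ 0
  lcaDepth-root z = n≤0⇒n≡0 (maxℕ-least _ at-root)
    where
    at-root : ∀ {x} → x ∈ map (dep u) (filterᵇ (λ w → isAnc u w z) (pathNodes u (inj₁ u))) → x ≤ 0
    at-root x∈ with ∈-map⁻ (dep u) x∈
    ... | w , w∈ , refl with ∈-chain-dep (dep u (inj₁ u)) (inj₁ u) (rootIn u) ≤-refl
                               (proj₁ (∈-filter⁻ (T? ∘ (λ w → isAnc u w z)) {xs = pathNodes u (inj₁ u)} w∈))
    ...   | i , _ , _ , dep-w = ≤-trans (m≤m+n (dep u w) i) (≤-reflexive (trans dep-w (rootDep u)))

  treeDist-root : ∀ z → treeDist u (inj₁ u) z ≡ dep u z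
  treeDist-root z = trans (cong (λ l → (dep u (inj₁ u) + dep u z) ∸ (2 * l)) (lcaDepth-root z))
                          (cong (_+ dep u z) (rootDep u))

  dep≤diamMax : ∀ {z} → inT u z ≡ true → dep u z ≤ diamMax
  dep≤diamMax {z} z∈T = subst (_≤ diamMax) (treeDist-root z) (maxℕ-upper
    (∈-concat⁺′ (∈-concat⁺′ (∈-map⁺ (treeDist u (inj₁ u)) (in-tree (∈-Nodes z) z∈T))
                            (∈-map⁺ _ (in-tree (∈-Nodes (inj₁ u)) (rootIn u))))
                (∈-map⁺ _ (∈-allFin u))))
    where
    in-tree : ∀ {x} → x ∈ Nodes → inT u x ≡ true → x ∈ filterᵇ (inT u) Nodes
    in-tree x∈ x∈T = ∈-filter⁺ (T? ∘ inT u) x∈ (Equivalence.from T-≡ x∈T)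

  -- A non-root skeleton node has positive reach, hence a strictly deeper descendant in T_u.
  inSkel∖root⇒dep< : ∀ {y} → T (inSkel∖root y) → dep u y < diamMax
  inSkel∖root⇒dep< {y} t with inSkel∖root⁻ t
  ... | sk , 1≤dep with inSkel⁻ sk
  ...   | _ , dep≤2reach with maxℕ-attained (map (λ x → dep u x ∸ dep u y) (filterᵇ (λ x → inT u x ∧ isAnc u y x) Nodes))
  ...     | inj₁ reach≡0 = ⊥-elim (<-irrefl refl (≤-trans 1≤dep (subst (λ r → dep u y ≤ 2 * r) reach≡0 dep≤2reach)))
  ...     | inj₂ reach∈ with ∈-map⁻ _ reach∈
  ...       | z , z∈ , reach≡ = ≤-trans (m∸n≢0⇒n<m reach≢0) (dep≤diamMax z∈T)
    where
    z∈T : inT u z ≡ true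
    z∈T = Equivalence.to T-≡ (proj₁ (Equivalence.to T-∧
            (proj₂ (∈-filter⁻ (T? ∘ (λ x → inT u x ∧ isAnc u y x)) {xs = Nodes} z∈))))
    reach≢0 : dep u z ∸ dep u y ≢ 0
    reach≢0 eq = <-irrefl refl (≤-trans 1≤dep (subst (λ r → dep u y ≤ 2 * r) (trans reach≡ eq) dep≤2reach))

  depthCount : ℕ → ℕ
  depthCount r = ∑ Nodes (λ y → 𝟙 (inSkel∖root y) * NatMult.δ r (dep u y))

  isk-by-depth : isk u ≡ ∑ℚ (downFrom diamMax) (λ r → ℕ→ℚ (depthCount r) *ℚ inv r)
  isk-by-depth = ∑ℚ-by-value Nodes inSkel∖root (dep u) inv diamMax inSkel∖root⇒dep<

  depthCount≤cutSize : ∀ r → depthCount r ≤ cutSize u r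
  depthCount≤cutSize r = ≤-trans (∑-mono-≤ Nodes (λ {y} _ → counted y)) (≤-reflexive (sym (length-filterᵇ _ Nodes)))
    where
    counted : ∀ y → 𝟙 (inSkel∖root y) * NatMult.δ r (dep u y) ≤ 𝟙 (inSkel u y ∧ ⌊ dep u y ℕ.≟ r ⌋)
    counted y with inSkel∖root y in sk | dep u y ℕ.≟ r
    ... | false | _        = z≤n
    ... | true  | no  d≢r rewrite NatMult.δ-≢ (d≢r ∘ sym) = z≤n
    ... | true  | yes refl rewrite NatMult.δ-refl (dep u y) =
      ≤-reflexive (sym (𝟙-T (Equivalence.from T-∧ (proj₁ (inSkel∖root⁻ {y} (Equivalence.from T-≡ sk)) , tt))))

  depthCount≤skelDim : ∀ r → depthCount r ≤ skelDim
  depthCount≤skelDim r with r ≤? n + m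
  ... | yes r≤n+m = ≤-trans (depthCount≤cutSize r) (maxℕ-upper
          (∈-concat⁺′ (∈-map⁺ (cutSize u) (∈-upTo⁺ (s≤s r≤n+m))) (∈-map⁺ _ (∈-allFin u))))
  ... | no  r≰n+m = ≤-trans (≤-reflexive (trans (∑-≗ Nodes too-deep) (∑-zero Nodes))) z≤n
    where
    too-deep : ∀ y → 𝟙 (inSkel∖root y) * NatMult.δ r (dep u y) ≡ 0
    too-deep y with inSkel∖root y in sk | NatMult.δ-cases r (dep u y)
    ... | false | _              = refl
    ... | true  | inj₂ (_ , δ≡0) rewrite δ≡0 = refl
    ... | true  | inj₁ (refl , _) = ⊥-elim (r≰n+m (≤-trans (n≤1+n _)
            (depth-bound y (proj₁ (inSkel⁻ (proj₁ (inSkel∖root⁻ {y} (Equivalence.from T-≡ sk))))))))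

  isk-≤ : isk u ≤ℚ ℕ→ℚ (skelDim * (2 * ⌊log₂ diamMax ⌋))
  isk-≤ = begin
    isk u                                               ≡⟨ isk-by-depth ⟩
    ∑ℚ (downFrom D) (λ r → ℕ→ℚ (depthCount r) *ℚ inv r) ≤⟨ ∑ℚ-mono-≤ (downFrom D) (λ {r} _ →
                                                             *-monoʳ-≤-nonNeg (inv-nonNeg r) (ℕ→ℚ-mono-≤ (depthCount≤skelDim r))) ⟩
    ∑ℚ (downFrom D) (λ r → ℕ→ℚ skelDim *ℚ inv r)        ≡⟨ ℚ∑.∑-*ˡ (downFrom D) (ℕ→ℚ skelDim) inv ⟩
    ℕ→ℚ skelDim *ℚ ∑ℚ (downFrom D) inv                  ≡⟨ cong (ℕ→ℚ skelDim *ℚ_) (∑ℚ-downFrom-inv D) ⟩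
    ℕ→ℚ skelDim *ℚ H (D ∸ 1)                            ≤⟨ *-monoˡ-≤-nonNeg (ℕ→ℚ-nonNeg skelDim) (H-≤-2log₂ D) ⟩
    ℕ→ℚ skelDim *ℚ ℕ→ℚ (2 * ⌊log₂ D ⌋)                  ≡⟨ sym (ℕ→ℚ-* skelDim (2 * ⌊log₂ D ⌋)) ⟩
    ℕ→ℚ (skelDim * (2 * ⌊log₂ D ⌋))                     ∎
    where
    open ℚP.≤-Reasoning
    D = diamMax

sumIsk-≤ : ∀ R → Valid R → let open RawOps R in sumIsk ≤ℚ ℕ→ℚ (2 * n * skelDim * ⌊log₂ diamMax ⌋)
sumIsk-≤ R V = begin
  sumIsk                                    ≤⟨ ∑ℚ-mono-≤ (allFin n) (λ {u} _ → SkeletonDepths.isk-≤ R V u) ⟩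
  ∑ℚ (allFin n) (const (ℕ→ℚ X))             ≡⟨ ∑ℚ-const (allFin n) (ℕ→ℚ X) ⟩
  ℕ→ℚ (length (allFin n)) *ℚ ℕ→ℚ X          ≡⟨ cong (λ k → ℕ→ℚ k *ℚ ℕ→ℚ X) (length-tabulate {n = n} (λ i → i)) ⟩
  ℕ→ℚ n *ℚ ℕ→ℚ X                            ≡⟨ sym (ℕ→ℚ-* n X) ⟩
  ℕ→ℚ (n * X)                               ≡⟨ cong ℕ→ℚ (regroup n skelDim ⌊log₂ diamMax ⌋) ⟩
  ℕ→ℚ (2 * n * skelDim * ⌊log₂ diamMax ⌋)   ∎
  where
  open RawOps R
  open ℚP.≤-Reasoning
  X = skelDim * (2 * ⌊log₂ diamMax ⌋)
  regroup : ∀ a b c → a * (b * (2 * c)) ≡ 2 * a * b * c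
  regroup = solve-∀

mainTheorem2 : ∃[ C₁ ] ∃[ C₂ ] ∀ (R : Raw) → Valid R → let open RawOps R in
    (length rankings
       ≤ 2 * length (filterᵇ (λ ρ → ℕ→ℚ (sumS (lookup ρ)) ≤ᵇ (ℕ→ℚ C₁ *ℚ sumIsk)) rankings))
    × (sumIsk ≤ℚ ℕ→ℚ (C₂ * n * skelDim * ⌊log₂ diamMax ⌋))
mainTheorem2 = 32 , 2 , λ R V → sumS-≤-32-sumIsk-with-probability-½ R V , sumIsk-≤ R V
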